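{- Let $k$ be a perfect field of characteristic $p>0$, $m\ge2$ with $p\nmid m$, $f\in k[x]$ squarefree of degree $d\ge3$, and $X\colon y^m=f(x)$ the corresponding superelliptic curve with function field $K$. For $1\le j\le m_1:=m-\lfloor m/d\rfloor-1$ let $\vec\omega_j=\{\omega_{ij}: 1\le i\le d_j\}$ where $d_j=d-\lfloor dj/m\rfloor-1$. Let $1\le j,\ell\le m_1$ with $\ell\equiv jp\pmod m$. Then the Cartier operator maps the $k$-span of $\vec\omega_\ell$ into the $k$-span of $\vec\omega_j$, and this action is given by the matrix $B^{j\ell}=[(b^{j\ell}_{ik})^{1/p}]$, namely $\mathcal{C}(\omega_{k\ell})=\sum_{i=1}^{d_j}(b^{j\ell}_{ik})^{1/p}\omega_{ij}$ for $1\le k\le d_\ell$. In particular, when $p\equiv1\pmod m$, the Cartier operator maps each span of $\vec\omega_j$ into itself.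
   Context: The superelliptic curve $X$ is the smooth projective curve with function field $K=k(x)[y]/(y^m-f(x))$. The Cartier operator $\mathcal{C}\colon\Omega_K\to\Omega_K$ is defined by writing any differential uniquely as $(z_0^p+z_1^px+\cdots+z_{p-1}^px^{p-1})dx$ with $z_i\in K$ and setting $\mathcal{C}$ of it equal to $z_{p-1}dx$. Put $F=y^m-f(x)$, $F_y=my^{m-1}$, $\omega_{ij}=x^{i-1}y^{j-1}dx/F_y$; the $\omega_{ij}$ with $i,j\ge1$ and $mi+dj<md$ form a basis of the regular differentials. For $n\ge0$ and $a\in\mathbf{Z}$ let $f^n_a$ denote the coefficient of $x^a$ in $f(x)^n$ (zero if $a<0$ or $a>nd$). Set $n_j=p-1-\lfloor jp/m\rfloor$ and, for $1\le i\le d_j$, $1\le k\le d_\ell$, $b^{j\ell}_{ik}=f^{n_j}_{ip-k}$ if $(jp-\ell)/m\in\mathbf{Z}_{\ge0}$ and $b^{j\ell}_{ik}=0$ otherwise. -}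

module Defs where

open import Level using (Level; _⊔_) renaming (suc to lsuc)
open import Data.Nat using (ℕ; zero; suc; _∸_; _≤_; _<_) renaming (_+_ to _+ℕ_; _*_ to _*ℕ_)
open import Data.Nat.DivMod using (_/_)
open import Data.Nat.Divisibility using (_∣?_)
open import Data.Integer using (ℤ; +_; _-_)
import Data.Integer.Divisibility as ℤD
open import Data.List using (List; []; _∷_; map; replicate; _++_)
open import Data.Unit.Polymorphic using (⊤)
open import Data.Product using (Σ; _×_; _,_; ∃)
open import Relation.Nullary using (¬_; yes; no)
open import Relation.Nullary.Decidable using (⌊_⌋)
open import Data.Nat using (_≤?_)
open import Algebra.Bundles using (CommutativeRing)

-- floor division ⌊a/b⌋ (the value for b = 0 is an irrelevant convention)
_div_ : ℕ → ℕ → ℕ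
a div zero = zero
a div suc b = a / suc b

_≡_[mod_] : ℕ → ℕ → ℕ → Set
a ≡ b [mod m ] = (+ m) ℤD.∣ ((+ a) - (+ b))

m₁ : ℕ → ℕ → ℕ
m₁ m d = m ∸ (m div d) ∸ 1

dⱼ : ℕ → ℕ → ℕ → ℕ
dⱼ m d j = d ∸ ((d *ℕ j) div m) ∸ 1

nⱼ : ℕ → ℕ → ℕ → ℕ
nⱼ p m j = p ∸ 1 ∸ ((j *ℕ p) div m)

-- Generic (dense, low-degree-first) polynomials over a "raw ring" with a
-- setoid equality; equality of coefficient lists is up to trailing zeros.

module PolyOver {a ℓ : Level} (A : Set a) (_≈_ : A → A → Set ℓ)
                (0# 1# : A) (_+_ _*_ : A → A → A) (negA : A → A) where

  Poly : Set a
  Poly = List A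

  _≈P_ : Poly → Poly → Set ℓ
  [] ≈P [] = ⊤
  [] ≈P (b ∷ bs) = (0# ≈ b) × ([] ≈P bs)
  (a ∷ as) ≈P [] = (a ≈ 0#) × (as ≈P [])
  (a ∷ as) ≈P (b ∷ bs) = (a ≈ b) × (as ≈P bs)

  _⊕_ : Poly → Poly → Poly
  [] ⊕ q = q
  (a ∷ p) ⊕ [] = a ∷ p
  (a ∷ p) ⊕ (b ∷ q) = (a + b) ∷ (p ⊕ q)

  neg : Poly → Poly
  neg = map negA

  scale : A → Poly → Poly
  scale c = map (c *_)

  _⊗_ : Poly → Poly → Poly
  [] ⊗ q = []
  (a ∷ p) ⊗ q = scale a q ⊕ (0# ∷ (p ⊗ q))

  const : A → Poly
  const c = c ∷ []

  one : Poly
  one = const 1#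

  varPow : ℕ → Poly
  varPow n = replicate n 0# ++ (1# ∷ [])

  pow : Poly → ℕ → Poly
  pow q zero = one
  pow q (suc n) = q ⊗ pow q n

  coeff : Poly → ℕ → A
  coeff [] n = 0#
  coeff (a ∷ p) zero = a
  coeff (a ∷ p) (suc n) = coeff p n

module _ {c ℓ : Level} (R : CommutativeRing c ℓ) where
  open CommutativeRing R

  _×1 : ℕ → Carrier
  zero ×1 = 0#
  suc n ×1 = 1# + (n ×1)

  powR : Carrier → ℕ → Carrier
  powR x zero = 1#
  powR x (suc n) = x * powR x n

  IsField : Set (c ⊔ ℓ)
  IsField = (¬ (1# ≈ 0#)) × (∀ x → ¬ (x ≈ 0#) → Σ Carrier λ y → (x * y) ≈ 1#)

  -- for p prime: k has characteristic p
  HasCharacteristic : ℕ → Set ℓ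
  HasCharacteristic p = (p ×1) ≈ 0#

  IsPerfect : ℕ → Set (c ⊔ ℓ)
  IsPerfect p = ∀ x → Σ Carrier λ y → powR y p ≈ x

-- The function field K = Frac(k[x,y]/(y^m - f(x))) of the superelliptic
-- curve, its differentials (g dx, g ∈ K) and the Cartier operator.

module Superelliptic {c ℓ : Level} (R : CommutativeRing c ℓ) where
  open CommutativeRing R
  open PolyOver Carrier _≈_ 0# 1# _+_ _*_ -_ public
    using (Poly; _≈P_; coeff)
  module P = PolyOver Carrier _≈_ 0# 1# _+_ _*_ -_
  -- bivariate polynomials: polynomials in y with coefficients in k[x]
  module B = PolyOver P.Poly P._≈P_ [] P.one P._⊕_ P._⊗_ P.neg

  Bivar : Set c
  Bivar = B.Poly

  mon : ℕ → ℕ → Bivar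
  mon a b = replicate b [] ++ (P.varPow a ∷ [])

  bconst : Carrier → Bivar
  bconst x = P.const x ∷ []

  Fpoly : ℕ → Poly → Bivar
  Fpoly m f = mon 0 m B.⊕ B.neg (f ∷ [])

  module Field (m : ℕ) (f : Poly) where
    _≡I_ : Bivar → Bivar → Set (c ⊔ ℓ)
    u ≡I v = Σ Bivar λ q → u B.≈P (v B.⊕ (q B.⊗ Fpoly m f))

    -- elements of K as fractions num/den with den ∉ (F)
    Frac : Set c
    Frac = Bivar × Bivar

    ValidFrac : Frac → Set (c ⊔ ℓ)
    ValidFrac (u , v) = ¬ (v ≡I [])

    _≈K_ : Frac → Frac → Set (c ⊔ ℓ)
    (u , v) ≈K (u' , v') = (u B.⊗ v') ≡I (u' B.⊗ v)

    _+K_ : Frac → Frac → Frac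
    (u , v) +K (u' , v') = ((u B.⊗ v') B.⊕ (u' B.⊗ v)) , (v B.⊗ v')

    _*K_ : Frac → Frac → Frac
    (u , v) *K (u' , v') = (u B.⊗ u') , (v B.⊗ v')

    0K 1K : Frac
    0K = [] , B.one
    1K = B.one , B.one

    ofBivar : Bivar → Frac
    ofBivar u = u , B.one

    scalarK : Carrier → Frac
    scalarK x = ofBivar (bconst x)

    xK : Frac
    xK = ofBivar (mon 1 0)

    powK : Frac → ℕ → Frac
    powK z zero = 1K
    powK z (suc n) = z *K powK z n

    sumK : ℕ → (ℕ → Frac) → Frac
    sumK zero g = 0K
    sumK (suc n) g = sumK n g +K g n

    -- A differential of K is g dx with g ∈ K (Ω_K = K dx); we represent it by g.
    -- ω_{ij} = x^{i-1} y^{j-1} dx / F_y,  F_y = m y^{m-1}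
    ω : ℕ → ℕ → Frac
    ω i j = mon (i ∸ 1) (j ∸ 1) , (bconst (_×1 R m) B.⊗ mon 0 (m ∸ 1))
    -- Cartier operator, as in the paper: C(g dx) = z_{p-1} dx where
    -- g = z_0^p + z_1^p x + ⋯ + z_{p-1}^p x^{p-1} (z_r ∈ K).
    CartierMaps : ℕ → Frac → Frac → Set (c ⊔ ℓ)
    CartierMaps p g h =
      Σ (ℕ → Frac) λ z →
        (∀ r → r < p → ValidFrac (z r)) ×
        (g ≈K sumK p (λ r → powK (z r) p *K powK xK r)) ×
        (z (p ∸ 1) ≈K h)

  SquareFree : Poly → Set (c ⊔ ℓ)
  SquareFree f = ∀ g h → f ≈P ((g P.⊗ g) P.⊗ h) → Σ Carrier λ a → g ≈P P.const a

  fcoeff : Poly → ℕ → ℕ → Carrier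
  fcoeff f n a = coeff (P.pow f n) a

  bcoef : ℕ → ℕ → Poly → ℕ → ℕ → ℕ → ℕ → Carrier
  bcoef p m f j l i k with l ≤? j *ℕ p
  ... | no _ = 0#
  ... | yes _ with m ∣? (j *ℕ p ∸ l)
  ...   | no _ = 0#
  ...   | yes _ with k ≤? i *ℕ p
  ...     | no _ = 0#        -- negative exponent: coefficient 0
  ...     | yes _ = fcoeff f (nⱼ p m j) (i *ℕ p ∸ k)

{-# OPTIONS --safe #-}
module Submission where

open import Defs
open import Level using (Level; _⊔_)
open import Data.Nat using (ℕ; zero; suc; NonZero; _≤_; _<_; _∸_; s≤s; z≤n; >-nonZero)
  renaming (_+_ to _+ℕ_; _*_ to _*ℕ_)
open import Data.Nat.Properties using (≤-<-trans; ≤-trans)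
open import Data.Nat.Divisibility using (_∣_)
open import Data.Nat.Primality using (Prime; prime⇒nonZero)
open import Data.Vec using (Vec; last; toList)
open import Data.Product using (Σ; _×_; _,_; proj₁; proj₂)
open import Data.List using ([]; _∷_; length; replicate; _++_)
open import Data.Empty using (⊥-elim)
open import Data.Unit.Polymorphic using (tt)
open import Relation.Nullary using (¬_)
open import Relation.Binary.PropositionalEquality as ≡ using (_≡_)
open import Algebra.Bundles using (CommutativeRing)

-- Let μ = 1/m; since m lies in the prime field, μ^p = μ.  With jp = ℓ + t m (t = ⌊jp/m⌋) and y^m = f,
-- y^{ℓ-1}/y^{m-1} = y^{jp}/f^{t+1} = y^{jp} f^{n_j}/f^p, so ω_{kℓ} = (μ y^j/f)^p · x^{k-1} f^{n_j} dx.
-- Sorting the exponents of x^{k-1} f^{n_j} = Σ c_a x^a by their residue mod p and taking p-th roots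
-- coefficientwise (Frobenius is additive) gives x^{k-1} f^{n_j} = Σ_{r<p} G_r^p x^r with
-- G_r = Σ_s c_{sp+r}^{1/p} x^s, so C(ω_{kℓ}) = (μ y^j/f) G_{p-1} dx.  The coefficient c_{(s+1)p-1} is
-- b^{jℓ}_{s+1,k}, it vanishes for s ≥ d_j by a degree count, and μ y^j x^s/f dx = ω_{s+1,j} because
-- y^j/f = y^{j-1}/y^{m-1}.  An equality in K is an equality of cross-multiplied numerators modulo
-- F = y^m − f, so all computations take place in k[x][y]/(F); of K itself only f ∉ (F) is needed.

module PrimeBinomial where
  open import Data.Nat
  open import Data.Nat.Properties
  open import Data.Nat.Combinatorics using (_C_; nC1≡n; nCk+nC[k+1]≡[n+1]C[k+1])
  open import Data.Nat.Divisibility using (divides; ∣⇒≤)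
  open import Data.Nat.Primality using (euclidsLemma)
  open import Data.Nat.Tactic.RingSolver using (solve-∀)
  open import Data.Sum using (inj₁; inj₂)
  open import Relation.Binary.PropositionalEquality
  open import Relation.Nullary using (contradiction)

  [1+k]*[1+n]C[1+k]≡[1+n]*nCk : ∀ n k → suc k * (suc n C suc k) ≡ suc n * (n C k)
  [1+k]*[1+n]C[1+k]≡[1+n]*nCk zero    zero    = refl
  [1+k]*[1+n]C[1+k]≡[1+n]*nCk zero    (suc k) = *-zeroʳ (2 + k)
  [1+k]*[1+n]C[1+k]≡[1+n]*nCk (suc n) zero    = trans (+-identityʳ _) (trans (nC1≡n (2 + n)) (sym (*-identityʳ _)))
  [1+k]*[1+n]C[1+k]≡[1+n]*nCk (suc n) (suc k) = begin
    (2 + k) * ((2 + n) C (2 + k))               ≡⟨ cong ((2 + k) *_) (nCk+nC[k+1]≡[n+1]C[k+1] (suc n) (suc k)) ⟨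
    (2 + k) * (a + b)                           ≡⟨ regroup a b k ⟩
    (suc k * a + a) + (2 + k) * b               ≡⟨ cong₂ (λ u v → (u + a) + v)
                                                     ([1+k]*[1+n]C[1+k]≡[1+n]*nCk n k)
                                                     ([1+k]*[1+n]C[1+k]≡[1+n]*nCk n (suc k)) ⟩
    (suc n * (n C k) + a) + suc n * (n C suc k) ≡⟨ collect (suc n) (n C k) (n C suc k) a ⟩
    suc n * (n C k + n C suc k) + a             ≡⟨ cong (λ u → suc n * u + a) (nCk+nC[k+1]≡[n+1]C[k+1] n k) ⟩
    suc n * a + a                               ≡⟨ +-comm (suc n * a) a ⟩
    (2 + n) * a                                 ∎
    where
    open ≡-Reasoning
    a b : ℕ
    a = suc n C suc k
    b = suc n C (2 + k)
    regroup : ∀ a b x → (2 + x) * (a + b) ≡ (suc x * a + a) + (2 + x) * b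
    regroup = solve-∀
    collect : ∀ x u v a → (x * u + a) + x * v ≡ x * (u + v) + a
    collect = solve-∀

  prime∣pCk : ∀ {p} → Prime p → ∀ {k} → 0 < k → k < p → p ∣ p C k
  prime∣pCk {suc n} p-prime {suc k} _ k<p
    with euclidsLemma (suc k) (suc n C suc k) p-prime
           (divides (n C k) (trans ([1+k]*[1+n]C[1+k]≡[1+n]*nCk n k) (*-comm (suc n) (n C k))))
  ... | inj₂ p∣pCk = p∣pCk
  ... | inj₁ p∣1+k = contradiction (∣⇒≤ p∣1+k) (<⇒≱ k<p)

module CommutativeRingProperties {c ℓ : Level} (R : CommutativeRing c ℓ) where
  import Data.Nat.Properties as ℕ
  open import Data.Nat.Divisibility using (divides)
  open import Data.Nat.Combinatorics using (nCn≡1)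
  open import Data.Nat.Primality using (prime⇒irreducible)
  open import Data.Nat.Coprimality using (Coprime; coprime-Bézout)
  open import Data.Nat.GCD using (module Bézout)
  open import Data.Sum using (inj₁; inj₂)
  open import Relation.Nullary using (contradiction)
  open import Data.Fin using (Fin; toℕ; inject₁; fromℕ) renaming (zero to fzero; suc to fsuc)
  import Data.Fin.Properties as Fin
  open CommutativeRing R hiding (zero)
  open import Algebra.Properties.CommutativeSemigroup +-commutativeSemigroup using (interchange)
  open import Algebra.Properties.CommutativeSemiring.Exp commutativeSemiring public
    using (_^_; ^-congˡ; ^-homo-*; ^-assocʳ; ^-distrib-*)
  open import Algebra.Properties.Monoid.Mult +-monoid using (×-congʳ) renaming (_×_ to _×ᵐ_)
  open import Algebra.Properties.Semiring.Mult semiring using (×-assoc-*) renaming (×1-homo-* to ×1#-homo-*)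
  open import Relation.Binary.Reasoning.Setoid setoid

  ∑ : ℕ → (ℕ → Carrier) → Carrier
  ∑ zero    g = 0#
  ∑ (suc n) g = ∑ n g + g n

  ∑-cong : ∀ n {g h : ℕ → Carrier} → (∀ r → r < n → g r ≈ h r) → ∑ n g ≈ ∑ n h
  ∑-cong zero    g≈h = refl
  ∑-cong (suc n) g≈h = +-cong (∑-cong n (λ r r<n → g≈h r (ℕ.m<n⇒m<1+n r<n))) (g≈h n ℕ.≤-refl)

  ∑-zero : ∀ n {g} → (∀ r → r < n → g r ≈ 0#) → ∑ n g ≈ 0#
  ∑-zero n g≈0 = trans (∑-cong n g≈0) (∑-0 n)
    where
    ∑-0 : ∀ n → ∑ n (λ _ → 0#) ≈ 0#
    ∑-0 zero    = refl
    ∑-0 (suc n) = trans (+-identityʳ _) (∑-0 n)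

  ∑-distrib-+ : ∀ n g h → ∑ n (λ r → g r + h r) ≈ ∑ n g + ∑ n h
  ∑-distrib-+ zero    g h = sym (+-identityˡ 0#)
  ∑-distrib-+ (suc n) g h = trans (+-congʳ (∑-distrib-+ n g h)) (interchange _ _ _ _)

  *-distribˡ-∑ : ∀ n x g → x * ∑ n g ≈ ∑ n (λ r → x * g r)
  *-distribˡ-∑ zero    x g = zeroʳ x
  *-distribˡ-∑ (suc n) x g = trans (distribˡ x _ _) (+-congʳ (*-distribˡ-∑ n x g))

  *-distribʳ-∑ : ∀ n x g → ∑ n g * x ≈ ∑ n (λ r → g r * x)
  *-distribʳ-∑ n x g =
    trans (*-comm _ x) (trans (*-distribˡ-∑ n x g) (∑-cong n (λ r _ → *-comm x (g r))))

  ∑-head : ∀ n g → ∑ (suc n) g ≈ g 0 + ∑ n (λ r → g (suc r))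
  ∑-head zero    g = trans (+-identityˡ _) (sym (+-identityʳ _))
  ∑-head (suc n) g = trans (+-congʳ (∑-head n g)) (+-assoc _ _ _)

  ∑-split : ∀ a b g → ∑ (a +ℕ b) g ≈ ∑ a g + ∑ b (λ i → g (a +ℕ i))
  ∑-split a zero    g rewrite ℕ.+-identityʳ a = sym (+-identityʳ _)
  ∑-split a (suc b) g rewrite ℕ.+-suc a b = trans (+-congʳ (∑-split a b g)) (+-assoc _ _ _)

  ∑-comm : ∀ m n (h : ℕ → ℕ → Carrier) → ∑ m (λ s → ∑ n (h s)) ≈ ∑ n (λ r → ∑ m (λ s → h s r))
  ∑-comm zero    n h = sym (∑-zero n (λ _ _ → refl))
  ∑-comm (suc m) n h = trans (+-congʳ (∑-comm m n h)) (sym (∑-distrib-+ n _ _))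

  ∑-* : ∀ m n h → ∑ (m *ℕ n) h ≈ ∑ n (λ r → ∑ m (λ s → h (s *ℕ n +ℕ r)))
  ∑-* m n h = trans (rows m) (∑-comm m n (λ s r → h (s *ℕ n +ℕ r)))
    where
    rows : ∀ m → ∑ (m *ℕ n) h ≈ ∑ m (λ s → ∑ n (λ r → h (s *ℕ n +ℕ r)))
    rows zero    = refl
    rows (suc m) rewrite ℕ.+-comm n (m *ℕ n) = trans (∑-split (m *ℕ n) n h) (+-congʳ (rows m))

  1^n≈1 : ∀ n → 1# ^ n ≈ 1#
  1^n≈1 zero    = refl
  1^n≈1 (suc n) = trans (*-identityˡ _) (1^n≈1 n)

  powR≡^ : ∀ x n → powR R x n ≡ x ^ n
  powR≡^ x zero    = ≡.refl
  powR≡^ x (suc n) = ≡.cong (x *_) (powR≡^ x n)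

  ×1≡×1# : ∀ n → _×1 R n ≡ n ×ᵐ 1#
  ×1≡×1# zero    = ≡.refl
  ×1≡×1# (suc n) = ≡.cong (1# +_) (×1≡×1# n)

  ×1-homo-* : ∀ a b → _×1 R (a *ℕ b) ≈ _×1 R a * _×1 R b
  ×1-homo-* a b rewrite ×1≡×1# (a *ℕ b) | ×1≡×1# a | ×1≡×1# b = ×1#-homo-* a b

  ×1-multiple≈0 : ∀ q {n} → _×1 R n ≈ 0# → _×1 R (q *ℕ n) ≈ 0#
  ×1-multiple≈0 q {n} n≈0 = trans (×1-homo-* q n) (trans (*-congˡ n≈0) (zeroʳ _))

  module PrimeCharacteristic (p′ : ℕ) (p-prime : Prime (suc p′)) (char : HasCharacteristic R (suc p′)) where
    open import Algebra.Properties.CommutativeSemiring.Binomial commutativeSemiring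
      using (theorem; binomialTerm; binomialExpansion)
    open import Algebra.Properties.Monoid.Sum +-monoid
      using (sum; sum-init-last; sum-cong-≋; sum-replicate-zero)

    private
      p : ℕ
      p = suc p′

    [q*p]×x≈0 : ∀ q x → (q *ℕ p) ×ᵐ x ≈ 0#
    [q*p]×x≈0 q x = begin
      (q *ℕ p) ×ᵐ x         ≈⟨ ×-congʳ (q *ℕ p) (*-identityˡ x) ⟨
      (q *ℕ p) ×ᵐ (1# * x)  ≈⟨ ×-assoc-* (q *ℕ p) 1# x ⟨
      ((q *ℕ p) ×ᵐ 1#) * x  ≡⟨ ≡.cong (_* x) (×1≡×1# (q *ℕ p)) ⟨
      _×1 R (q *ℕ p) * x    ≈⟨ *-congʳ (×1-multiple≈0 q char) ⟩
      0# * x                ≈⟨ zeroˡ x ⟩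
      0#                    ∎

    -- All inner binomial terms carry a coefficient p C i divisible by p.
    frobenius : ∀ x y → (x + y) ^ p ≈ x ^ p + y ^ p
    frobenius x y = begin
      (x + y) ^ p                                   ≈⟨ theorem p x y ⟩
      binomialExpansion x y p                       ≡⟨⟩
      t fzero + sum (λ i → t (fsuc i))              ≈⟨ +-congˡ (sum-init-last (λ i → t (fsuc i))) ⟩
      t fzero + (sum (λ i → t (fsuc (inject₁ i))) + t (fsuc (fromℕ p′)))
                                                    ≈⟨ +-cong first-term (+-cong (sum-cong-≋ inner-zero) last-term) ⟩
      y ^ p + (sum (λ (_ : Fin p′) → 0#) + x ^ p)   ≈⟨ +-congˡ (+-congʳ (sum-replicate-zero p′)) ⟩
      y ^ p + (0# + x ^ p)                          ≈⟨ +-comm _ _ ⟩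
      (0# + x ^ p) + y ^ p                          ≈⟨ +-congʳ (+-identityˡ _) ⟩
      x ^ p + y ^ p                                 ∎
      where
      t : Fin (suc p) → Carrier
      t = binomialTerm x y p
      first-term : t fzero ≈ y ^ p
      first-term = trans (+-identityʳ _) (*-identityˡ _)
      last-term : t (fsuc (fromℕ p′)) ≈ x ^ p
      last-term rewrite Fin.toℕ-fromℕ p′ | nCn≡1 p | ℕ.n∸n≡0 p′ = trans (+-identityʳ _) (*-identityʳ _)
      inner-zero : ∀ (i : Fin p′) → t (fsuc (inject₁ i)) ≈ 0#
      inner-zero i with PrimeBinomial.prime∣pCk p-prime {suc (toℕ (inject₁ i))} (s≤s z≤n)
                          (s≤s (≡.subst (_< p′) (≡.sym (Fin.toℕ-inject₁ i)) (Fin.toℕ<n i)))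
      ... | divides q pCi≡q*p rewrite pCi≡q*p = [q*p]×x≈0 q _

    frobenius-∑ : ∀ n g → ∑ n g ^ p ≈ ∑ n (λ r → g r ^ p)
    frobenius-∑ zero    g = zeroˡ _
    frobenius-∑ (suc n) g = trans (frobenius _ _) (+-congʳ (frobenius-∑ n g))

    fermat : ∀ n → _×1 R n ^ p ≈ _×1 R n
    fermat zero    = zeroˡ _
    fermat (suc n) = trans (frobenius _ _) (+-cong (1^n≈1 p) (fermat n))

    -- A Bézout identity 1 + u ≡ v between multiples of p and of n would give 1 ≈ 0.
    p∤n⇒n×1≉0 : ∀ {n} → ¬ (1# ≈ 0#) → ¬ (p ∣ n) → ¬ (_×1 R n ≈ 0#)
    p∤n⇒n×1≉0 {n} 1≉0 p∤n n×1≈0 = 1≉0 (from-Bézout (coprime-Bézout p-coprime-n))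
      where
      p-coprime-n : Coprime p n
      p-coprime-n (d∣p , d∣n) with prime⇒irreducible p-prime d∣p
      ... | inj₁ d≡1    = d≡1
      ... | inj₂ ≡.refl = contradiction d∣n p∤n
      1≈0-from : ∀ {u v} → suc u ≡ v → _×1 R u ≈ 0# → _×1 R v ≈ 0# → 1# ≈ 0#
      1≈0-from ≡.refl u≈0 v≈0 = trans (sym (trans (+-congˡ u≈0) (+-identityʳ 1#))) v≈0
      from-Bézout : Bézout.Identity 1 p n → 1# ≈ 0#
      from-Bézout (Bézout.+- a b 1+bn≡ap) = 1≈0-from 1+bn≡ap (×1-multiple≈0 b n×1≈0) (×1-multiple≈0 a char)
      from-Bézout (Bézout.-+ a b 1+ap≡bn) = 1≈0-from 1+ap≡bn (×1-multiple≈0 a char) (×1-multiple≈0 b n×1≈0)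

module PrincipalQuotient {c ℓ : Level} (S : CommutativeRing c ℓ) (F : CommutativeRing.Carrier S) where
  open import Algebra.Structures using (IsCommutativeRing)
  open import Data.Maybe using (nothing)
  open import Tactic.RingSolver using (solve-∀)
  open import Tactic.RingSolver.Core.AlmostCommutativeRing
    using (AlmostCommutativeRing; fromCommutativeRing; module AlmostCommutativeRing)
  private
    module Identities where
      S′ : AlmostCommutativeRing c ℓ
      S′ = fromCommutativeRing S (λ _ → nothing)
      open AlmostCommutativeRing S′

      cofactors-+ : ∀ (w q q′ g : Carrier) → (w + q′ * g) + q * g ≈ w + (q′ + q) * g
      cofactors-+ = solve-∀ S′

      cofactors-interchange : ∀ (u v q q′ g : Carrier) → (u + q * g) + (v + q′ * g) ≈ (u + v) + (q + q′) * g
      cofactors-interchange = solve-∀ S′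

  open Identities
  open CommutativeRing S
  open import Algebra.Properties.Ring ring using (-‿distribˡ-*; -‿+-comm)
  open import Relation.Binary.Reasoning.Setoid setoid

  private
    cofactor-cancel : ∀ v q g → v ≈ (v + q * g) + (- q) * g
    cofactor-cancel v q g = sym (begin
      (v + q * g) + (- q) * g   ≈⟨ +-assoc v (q * g) ((- q) * g) ⟩
      v + (q * g + (- q) * g)   ≈⟨ +-congˡ (distribʳ g q (- q)) ⟨
      v + (q + - q) * g         ≈⟨ +-congˡ (*-congʳ (-‿inverseʳ q)) ⟩
      v + 0# * g                ≈⟨ +-congˡ (zeroˡ g) ⟩
      v + 0#                    ≈⟨ +-identityʳ v ⟩
      v                         ∎)

    cofactors-* : ∀ u v q q′ g → (u + q * g) * (v + q′ * g) ≈ u * v + (q * v + (u + q * g) * q′) * g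
    cofactors-* u v q q′ g = begin
      (u + q * g) * (v + q′ * g)                     ≈⟨ distribˡ (u + q * g) v (q′ * g) ⟩
      (u + q * g) * v + (u + q * g) * (q′ * g)       ≈⟨ +-cong (distribʳ v u (q * g)) (sym (*-assoc _ q′ g)) ⟩
      (u * v + (q * g) * v) + ((u + q * g) * q′) * g ≈⟨ +-congʳ (+-congˡ (*-assoc q g v)) ⟩
      (u * v + q * (g * v)) + ((u + q * g) * q′) * g ≈⟨ +-congʳ (+-congˡ (*-congˡ (*-comm g v))) ⟩
      (u * v + q * (v * g)) + ((u + q * g) * q′) * g ≈⟨ +-congʳ (+-congˡ (*-assoc q v g)) ⟨
      (u * v + (q * v) * g) + ((u + q * g) * q′) * g ≈⟨ +-assoc _ _ _ ⟩
      u * v + ((q * v) * g + ((u + q * g) * q′) * g) ≈⟨ +-congˡ (distribʳ g (q * v) _) ⟨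
      u * v + (q * v + (u + q * g) * q′) * g         ∎

    cofactor-neg : ∀ u q g → - (u + q * g) ≈ - u + (- q) * g
    cofactor-neg u q g = trans (sym (-‿+-comm u (q * g))) (+-congˡ (-‿distribˡ-* q g))

  -- A record rather than the Σ-type it wraps, so that the two sides of u ~ v can be inferred.
  record _~_ (u v : Carrier) : Set (c ⊔ ℓ) where
    constructor _,_
    field
      cofactor : Carrier
      ≈+cofactor* : u ≈ v + cofactor * F

  ~⇒Σ : ∀ {u v} → u ~ v → Σ Carrier λ q → u ≈ v + q * F
  ~⇒Σ (q , u≈v+qF) = q , u≈v+qF

  ≈⇒~ : ∀ {u v} → u ≈ v → u ~ v
  ≈⇒~ {u} {v} u≈v = 0# , trans u≈v (sym (trans (+-congˡ (zeroˡ F)) (+-identityʳ v)))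

  ~-sym : ∀ {u v} → u ~ v → v ~ u
  ~-sym {u} {v} (q , u≈v+qF) = - q , trans (cofactor-cancel v q F) (+-congʳ (sym u≈v+qF))

  ~-trans : ∀ {u v w} → u ~ v → v ~ w → u ~ w
  ~-trans {w = w} (q , u≈) (q′ , v≈) = q′ + q , trans u≈ (trans (+-congʳ v≈) (cofactors-+ w q q′ F))

  ~-+ : ∀ {u u′ v v′} → u ~ u′ → v ~ v′ → (u + v) ~ (u′ + v′)
  ~-+ {u′ = u′} {v′ = v′} (q , u≈) (q′ , v≈) =
    q + q′ , trans (+-cong u≈ v≈) (cofactors-interchange u′ v′ q q′ F)

  ~-* : ∀ {u u′ v v′} → u ~ u′ → v ~ v′ → (u * v) ~ (u′ * v′)
  ~-* {u′ = u′} {v′ = v′} (q , u≈) (q′ , v≈) = _ , trans (*-cong u≈ v≈) (cofactors-* u′ v′ q q′ F)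

  ~-neg : ∀ {u u′} → u ~ u′ → (- u) ~ (- u′)
  ~-neg {u′ = u′} (q , u≈) = - q , trans (-‿cong u≈) (cofactor-neg u′ q F)

  ~-isCommutativeRing : IsCommutativeRing _~_ _+_ _*_ -_ 0# 1#
  ~-isCommutativeRing = record
    { isRing = record
      { +-isAbelianGroup = record
        { isGroup = record
          { isMonoid = record
            { isSemigroup = record
              { isMagma = record
                { isEquivalence = record { refl = ≈⇒~ refl ; sym = ~-sym ; trans = ~-trans }
                ; ∙-cong = ~-+ }
              ; assoc = λ x y z → ≈⇒~ (+-assoc x y z) }
            ; identity = (λ x → ≈⇒~ (+-identityˡ x)) , (λ x → ≈⇒~ (+-identityʳ x)) }
          ; inverse = (λ x → ≈⇒~ (-‿inverseˡ x)) , (λ x → ≈⇒~ (-‿inverseʳ x))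
          ; ⁻¹-cong = ~-neg }
        ; comm = λ x y → ≈⇒~ (+-comm x y) }
      ; *-cong = ~-*
      ; *-assoc = λ x y z → ≈⇒~ (*-assoc x y z)
      ; *-identity = (λ x → ≈⇒~ (*-identityˡ x)) , (λ x → ≈⇒~ (*-identityʳ x))
      ; distrib = (λ x y z → ≈⇒~ (distribˡ x y z)) , (λ x y z → ≈⇒~ (distribʳ x y z)) }
    ; *-comm = λ x y → ≈⇒~ (*-comm x y) }

  quotientRing : CommutativeRing c (c ⊔ ℓ)
  quotientRing = record { isCommutativeRing = ~-isCommutativeRing }

  generator~0 : F ~ 0#
  generator~0 = 1# , trans (sym (*-identityˡ F)) (sym (+-identityˡ _))

module Polynomials {c ℓ : Level} (R : CommutativeRing c ℓ) where
  import Data.Nat.Properties as ℕ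
  open import Algebra.Structures using (IsCommutativeRing; IsCommutativeMonoid)
  open import Algebra.Bundles using (CommutativeSemigroup)
  import Algebra.Properties.CommutativeSemigroup as CommutativeSemigroupProperties
  open import Algebra.Properties.Group using (ε⁻¹≈ε)
  open CommutativeRing R hiding (zero)
  open import Relation.Binary.Reasoning.Setoid setoid
  open PolyOver Carrier _≈_ 0# 1# _+_ _*_ -_ public

  ≈P⇒coeff≈ : ∀ p q → p ≈P q → ∀ i → coeff p i ≈ coeff q i
  ≈P⇒coeff≈ []      []      _        i       = refl
  ≈P⇒coeff≈ []      (b ∷ q) (e , es) zero    = e
  ≈P⇒coeff≈ []      (b ∷ q) (e , es) (suc i) = ≈P⇒coeff≈ [] q es i
  ≈P⇒coeff≈ (a ∷ p) []      (e , es) zero    = e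
  ≈P⇒coeff≈ (a ∷ p) []      (e , es) (suc i) = ≈P⇒coeff≈ p [] es i
  ≈P⇒coeff≈ (a ∷ p) (b ∷ q) (e , es) zero    = e
  ≈P⇒coeff≈ (a ∷ p) (b ∷ q) (e , es) (suc i) = ≈P⇒coeff≈ p q es i

  coeff≈⇒≈P : ∀ {p q} → (∀ i → coeff p i ≈ coeff q i) → p ≈P q
  coeff≈⇒≈P {[]}    {[]}    _ = tt
  coeff≈⇒≈P {[]}    {b ∷ q} e = e zero , coeff≈⇒≈P (λ i → e (suc i))
  coeff≈⇒≈P {a ∷ p} {[]}    e = e zero , coeff≈⇒≈P (λ i → e (suc i))
  coeff≈⇒≈P {a ∷ p} {b ∷ q} e = e zero , coeff≈⇒≈P (λ i → e (suc i))

  ≈P-refl : ∀ {p} → p ≈P p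
  ≈P-refl = coeff≈⇒≈P (λ _ → refl)

  ≈P-sym : ∀ {p q} → p ≈P q → q ≈P p
  ≈P-sym {p} {q} e = coeff≈⇒≈P (λ i → sym (≈P⇒coeff≈ p q e i))

  ≈P-trans : ∀ {p q r} → p ≈P q → q ≈P r → p ≈P r
  ≈P-trans {p} {q} {r} e e′ = coeff≈⇒≈P (λ i → trans (≈P⇒coeff≈ p q e i) (≈P⇒coeff≈ q r e′ i))

  coeff-⊕ : ∀ p q i → coeff (p ⊕ q) i ≈ coeff p i + coeff q i
  coeff-⊕ []      q       i       = sym (+-identityˡ _)
  coeff-⊕ (a ∷ p) []      zero    = sym (+-identityʳ _)
  coeff-⊕ (a ∷ p) []      (suc i) = sym (+-identityʳ _)
  coeff-⊕ (a ∷ p) (b ∷ q) zero    = refl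
  coeff-⊕ (a ∷ p) (b ∷ q) (suc i) = coeff-⊕ p q i

  coeff-neg : ∀ p i → coeff (neg p) i ≈ - coeff p i
  coeff-neg []      i       = sym (ε⁻¹≈ε +-group)
  coeff-neg (a ∷ p) zero    = refl
  coeff-neg (a ∷ p) (suc i) = coeff-neg p i

  coeff-scale : ∀ x p i → coeff (scale x p) i ≈ x * coeff p i
  coeff-scale x []      i       = sym (zeroʳ x)
  coeff-scale x (a ∷ p) zero    = refl
  coeff-scale x (a ∷ p) (suc i) = coeff-scale x p i

  ⊕-cong : ∀ {p p′ q q′} → p ≈P p′ → q ≈P q′ → (p ⊕ q) ≈P (p′ ⊕ q′)
  ⊕-cong {p} {p′} {q} {q′} e e′ = coeff≈⇒≈P λ i → begin
    coeff (p ⊕ q) i         ≈⟨ coeff-⊕ p q i ⟩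
    coeff p i + coeff q i   ≈⟨ +-cong (≈P⇒coeff≈ p p′ e i) (≈P⇒coeff≈ q q′ e′ i) ⟩
    coeff p′ i + coeff q′ i ≈⟨ coeff-⊕ p′ q′ i ⟨
    coeff (p′ ⊕ q′) i       ∎

  ⊕-assoc : ∀ p q r → ((p ⊕ q) ⊕ r) ≈P (p ⊕ (q ⊕ r))
  ⊕-assoc p q r = coeff≈⇒≈P λ i → begin
    coeff ((p ⊕ q) ⊕ r) i               ≈⟨ coeff-⊕ (p ⊕ q) r i ⟩
    coeff (p ⊕ q) i + coeff r i         ≈⟨ +-congʳ (coeff-⊕ p q i) ⟩
    (coeff p i + coeff q i) + coeff r i ≈⟨ +-assoc _ _ _ ⟩
    coeff p i + (coeff q i + coeff r i) ≈⟨ +-congˡ (coeff-⊕ q r i) ⟨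
    coeff p i + coeff (q ⊕ r) i         ≈⟨ coeff-⊕ p (q ⊕ r) i ⟨
    coeff (p ⊕ (q ⊕ r)) i               ∎

  ⊕-comm : ∀ p q → (p ⊕ q) ≈P (q ⊕ p)
  ⊕-comm p q = coeff≈⇒≈P λ i → trans (coeff-⊕ p q i) (trans (+-comm _ _) (sym (coeff-⊕ q p i)))

  ⊕-identityʳ : ∀ p → (p ⊕ []) ≈P p
  ⊕-identityʳ p = coeff≈⇒≈P λ i → trans (coeff-⊕ p [] i) (+-identityʳ _)

  neg-cong : ∀ {p q} → p ≈P q → neg p ≈P neg q
  neg-cong {p} {q} e = coeff≈⇒≈P λ i →
    trans (coeff-neg p i) (trans (-‿cong (≈P⇒coeff≈ p q e i)) (sym (coeff-neg q i)))

  neg-inverseˡ : ∀ p → (neg p ⊕ p) ≈P []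
  neg-inverseˡ p = coeff≈⇒≈P λ i →
    trans (coeff-⊕ (neg p) p i) (trans (+-congʳ (coeff-neg p i)) (-‿inverseˡ _))

  neg-inverseʳ : ∀ p → (p ⊕ neg p) ≈P []
  neg-inverseʳ p = ≈P-trans (⊕-comm p (neg p)) (neg-inverseˡ p)

  ⊕-isCommutativeMonoid : IsCommutativeMonoid _≈P_ _⊕_ []
  ⊕-isCommutativeMonoid = record
    { isMonoid = record
      { isSemigroup = record
        { isMagma = record
          { isEquivalence = record { refl = ≈P-refl ; sym = ≈P-sym ; trans = ≈P-trans }
          ; ∙-cong = ⊕-cong }
        ; assoc = ⊕-assoc }
      ; identity = (λ _ → ≈P-refl) , ⊕-identityʳ }
    ; comm = ⊕-comm }

  private
    ⊕-commutativeSemigroup : CommutativeSemigroup c ℓ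
    ⊕-commutativeSemigroup = record
      { isCommutativeSemigroup = IsCommutativeMonoid.isCommutativeSemigroup ⊕-isCommutativeMonoid }
    module ⊕ = CommutativeSemigroupProperties ⊕-commutativeSemigroup

  scale-cong : ∀ {x y p q} → x ≈ y → p ≈P q → scale x p ≈P scale y q
  scale-cong {x} {y} {p} {q} x≈y e = coeff≈⇒≈P λ i →
    trans (coeff-scale x p i) (trans (*-cong x≈y (≈P⇒coeff≈ p q e i)) (sym (coeff-scale y q i)))

  scale-distribˡ : ∀ x p q → scale x (p ⊕ q) ≈P (scale x p ⊕ scale x q)
  scale-distribˡ x p q = coeff≈⇒≈P λ i → begin
    coeff (scale x (p ⊕ q)) i                  ≈⟨ coeff-scale x (p ⊕ q) i ⟩
    x * coeff (p ⊕ q) i                        ≈⟨ *-congˡ (coeff-⊕ p q i) ⟩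
    x * (coeff p i + coeff q i)                ≈⟨ distribˡ _ _ _ ⟩
    x * coeff p i + x * coeff q i              ≈⟨ +-cong (coeff-scale x p i) (coeff-scale x q i) ⟨
    coeff (scale x p) i + coeff (scale x q) i  ≈⟨ coeff-⊕ (scale x p) (scale x q) i ⟨
    coeff (scale x p ⊕ scale x q) i            ∎

  scale-distribʳ : ∀ x y p → scale (x + y) p ≈P (scale x p ⊕ scale y p)
  scale-distribʳ x y p = coeff≈⇒≈P λ i → begin
    coeff (scale (x + y) p) i                  ≈⟨ coeff-scale (x + y) p i ⟩
    (x + y) * coeff p i                        ≈⟨ distribʳ _ _ _ ⟩
    x * coeff p i + y * coeff p i              ≈⟨ +-cong (coeff-scale x p i) (coeff-scale y p i) ⟨
    coeff (scale x p) i + coeff (scale y p) i  ≈⟨ coeff-⊕ (scale x p) (scale y p) i ⟨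
    coeff (scale x p ⊕ scale y p) i            ∎

  scale-assoc : ∀ x y p → scale (x * y) p ≈P scale x (scale y p)
  scale-assoc x y p = coeff≈⇒≈P λ i → begin
    coeff (scale (x * y) p) i       ≈⟨ coeff-scale (x * y) p i ⟩
    (x * y) * coeff p i             ≈⟨ *-assoc _ _ _ ⟩
    x * (y * coeff p i)             ≈⟨ *-congˡ (coeff-scale y p i) ⟨
    x * coeff (scale y p) i         ≈⟨ coeff-scale x (scale y p) i ⟨
    coeff (scale x (scale y p)) i   ∎

  scale-zero : ∀ p → scale 0# p ≈P []
  scale-zero p = coeff≈⇒≈P λ i → trans (coeff-scale 0# p i) (zeroˡ _)

  scale-identity : ∀ p → scale 1# p ≈P p
  scale-identity p = coeff≈⇒≈P λ i → trans (coeff-scale 1# p i) (*-identityˡ _)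

  ⊗-zeroˡ : ∀ p q → p ≈P [] → (p ⊗ q) ≈P []
  ⊗-zeroˡ []      q _        = tt
  ⊗-zeroˡ (a ∷ p) q (a≈0 , p≈0) = ≈P-trans
    (⊕-cong {scale a q} {[]} {0# ∷ (p ⊗ q)} {0# ∷ []}
      (≈P-trans (scale-cong a≈0 ≈P-refl) (scale-zero q)) (refl , ⊗-zeroˡ p q p≈0))
    (refl , tt)

  ⊗-zeroʳ : ∀ p → (p ⊗ []) ≈P []
  ⊗-zeroʳ []      = tt
  ⊗-zeroʳ (a ∷ p) = refl , ⊗-zeroʳ p

  ⊗-congʳ : ∀ p {q q′} → q ≈P q′ → (p ⊗ q) ≈P (p ⊗ q′)
  ⊗-congʳ []      e = tt
  ⊗-congʳ (a ∷ p) e = ⊕-cong (scale-cong refl e) (refl , ⊗-congʳ p e)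

  ⊗-congˡ : ∀ {p p′} q → p ≈P p′ → (p ⊗ q) ≈P (p′ ⊗ q)
  ⊗-congˡ {[]}    {[]}     q e        = tt
  ⊗-congˡ {[]}    {b ∷ p′} q e        = ≈P-sym (⊗-zeroˡ (b ∷ p′) q (≈P-sym {[]} {b ∷ p′} e))
  ⊗-congˡ {a ∷ p} {[]}     q e        = ⊗-zeroˡ (a ∷ p) q e
  ⊗-congˡ {a ∷ p} {b ∷ p′} q (e , es) =
    ⊕-cong {scale a q} {scale b q} {0# ∷ (p ⊗ q)} {0# ∷ (p′ ⊗ q)} (scale-cong e ≈P-refl) (refl , ⊗-congˡ q es)

  ⊗-cong : ∀ {p p′ q q′} → p ≈P p′ → q ≈P q′ → (p ⊗ q) ≈P (p′ ⊗ q′)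
  ⊗-cong {p′ = p′} {q = q} e e′ = ≈P-trans (⊗-congˡ q e) (⊗-congʳ p′ e′)

  ⊗-distribʳ : ∀ q p p′ → ((p ⊕ p′) ⊗ q) ≈P ((p ⊗ q) ⊕ (p′ ⊗ q))
  ⊗-distribʳ q []      p′       = ≈P-refl
  ⊗-distribʳ q (a ∷ p) []       = ≈P-sym (⊕-identityʳ _)
  ⊗-distribʳ q (a ∷ p) (b ∷ p′) =
    ≈P-trans (⊕-cong (scale-distribʳ a b q) (sym (+-identityˡ 0#) , ⊗-distribʳ q p p′))
      (⊕.interchange (scale a q) (scale b q) (0# ∷ (p ⊗ q)) (0# ∷ (p′ ⊗ q)))

  ⊗-∷ : ∀ p b q → (p ⊗ (b ∷ q)) ≈P (scale b p ⊕ (0# ∷ (p ⊗ q)))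
  ⊗-∷ []      b q = refl , tt
  ⊗-∷ (a ∷ p) b q =
    +-congʳ (*-comm a b) ,
    ≈P-trans (⊕-cong (≈P-refl {scale a q}) (⊗-∷ p b q))
      (⊕.x∙yz≈y∙xz (scale a q) (scale b p) (0# ∷ (p ⊗ q)))

  ⊗-comm : ∀ p q → (p ⊗ q) ≈P (q ⊗ p)
  ⊗-comm []      q = ≈P-sym (⊗-zeroʳ q)
  ⊗-comm (a ∷ p) q = ≈P-trans (⊕-cong (≈P-refl {scale a q}) (refl , ⊗-comm p q)) (≈P-sym (⊗-∷ q a p))

  ⊗-distribˡ : ∀ p q q′ → (p ⊗ (q ⊕ q′)) ≈P ((p ⊗ q) ⊕ (p ⊗ q′))
  ⊗-distribˡ p q q′ = ≈P-trans (⊗-comm p (q ⊕ q′))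
    (≈P-trans (⊗-distribʳ p q q′) (⊕-cong (⊗-comm q p) (⊗-comm q′ p)))

  scale-⊗ : ∀ x q r → (scale x q ⊗ r) ≈P scale x (q ⊗ r)
  scale-⊗ x []      r = tt
  scale-⊗ x (b ∷ q) r =
    ≈P-trans (⊕-cong (scale-assoc x b r) (sym (zeroʳ x) , scale-⊗ x q r))
      (≈P-sym (scale-distribˡ x (scale b r) (0# ∷ (q ⊗ r))))

  ⊗-assoc : ∀ p q r → ((p ⊗ q) ⊗ r) ≈P (p ⊗ (q ⊗ r))
  ⊗-assoc []      q r = tt
  ⊗-assoc (a ∷ p) q r =
    ≈P-trans (⊗-distribʳ r (scale a q) (0# ∷ (p ⊗ q)))
      (⊕-cong (scale-⊗ a q r) (≈P-trans 0∷⊗ (refl , ⊗-assoc p q r)))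
    where
    0∷⊗ : ((0# ∷ (p ⊗ q)) ⊗ r) ≈P (0# ∷ ((p ⊗ q) ⊗ r))
    0∷⊗ = ⊕-cong {scale 0# r} {[]} {0# ∷ ((p ⊗ q) ⊗ r)} (scale-zero r) (≈P-refl {0# ∷ ((p ⊗ q) ⊗ r)})

  ⊗-identityˡ : ∀ p → (one ⊗ p) ≈P p
  ⊗-identityˡ p = ≈P-trans (⊕-cong (scale-identity p) (refl , tt)) (⊕-identityʳ p)

  ⊗-identityʳ : ∀ p → (p ⊗ one) ≈P p
  ⊗-identityʳ p = ≈P-trans (⊗-comm p one) (⊗-identityˡ p)

  ⊕-⊗-isCommutativeRing : IsCommutativeRing _≈P_ _⊕_ _⊗_ neg [] one
  ⊕-⊗-isCommutativeRing = record
    { isRing = record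
      { +-isAbelianGroup = record
        { isGroup = record
          { isMonoid = IsCommutativeMonoid.isMonoid ⊕-isCommutativeMonoid
          ; inverse = neg-inverseˡ , neg-inverseʳ
          ; ⁻¹-cong = neg-cong }
        ; comm = ⊕-comm }
      ; *-cong = ⊗-cong
      ; *-assoc = ⊗-assoc
      ; *-identity = ⊗-identityˡ , ⊗-identityʳ
      ; distrib = ⊗-distribˡ , ⊗-distribʳ }
    ; *-comm = ⊗-comm }

  polynomialRing : CommutativeRing c ℓ
  polynomialRing = record { isCommutativeRing = ⊕-⊗-isCommutativeRing }

  open CommutativeRingProperties polynomialRing public using () renaming (_^_ to _^P_; ∑ to ∑P)
  private
    module P = CommutativeRingProperties polynomialRing
    module K = CommutativeRingProperties R
    module ⊗ = CommutativeSemigroupProperties (CommutativeRing.*-commutativeSemigroup polynomialRing)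

  X : Poly
  X = varPow 1

  coeff-beyond-length : ∀ q i → length q ≤ i → coeff q i ≡ 0#
  coeff-beyond-length []      i       _         = ≡.refl
  coeff-beyond-length (a ∷ q) (suc i) (s≤s len≤i) = coeff-beyond-length q i len≤i

  coeff-0s++-+ : ∀ e g i → coeff (replicate e 0# ++ g) (e +ℕ i) ≡ coeff g i
  coeff-0s++-+ zero    g i = ≡.refl
  coeff-0s++-+ (suc e) g i = coeff-0s++-+ e g i

  coeff-0s++-< : ∀ e g i → i < e → coeff (replicate e 0# ++ g) i ≡ 0#
  coeff-0s++-< (suc e) g zero    _       = ≡.refl
  coeff-0s++-< (suc e) g (suc i) (s≤s i<e) = coeff-0s++-< e g i i<e

  X⊗ : ∀ q → (X ⊗ q) ≈P (0# ∷ q)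
  X⊗ q = ⊕-cong {scale 0# q} {[]} {0# ∷ (one ⊗ q)} {0# ∷ q} (scale-zero q) (refl , ⊗-identityˡ q)

  const⊗ : ∀ a q → (const a ⊗ q) ≈P scale a q
  const⊗ a q = ≈P-trans (⊕-cong {scale a q} {scale a q} {0# ∷ []} {[]} ≈P-refl (refl , tt)) (⊕-identityʳ _)

  const-homo-* : ∀ a b → const (a * b) ≈P (const a ⊗ const b)
  const-homo-* a b = ≈P-sym {const a ⊗ const b} {scale a (const b)} (const⊗ a (const b))

  const-homo-^ : ∀ a n → const (a K.^ n) ≈P (const a ^P n)
  const-homo-^ a zero    = ≈P-refl {one}
  const-homo-^ a (suc n) = ≈P-trans (const-homo-* a (a K.^ n)) (⊗-congʳ (const a) (const-homo-^ a n))

  0s++≈X^⊗ : ∀ e q → (replicate e 0# ++ q) ≈P ((X ^P e) ⊗ q)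
  0s++≈X^⊗ zero    q = ≈P-sym {one ⊗ q} {q} (⊗-identityˡ q)
  0s++≈X^⊗ (suc e) q =
    ≈P-trans {0# ∷ (replicate e 0# ++ q)} {0# ∷ ((X ^P e) ⊗ q)} (refl , 0s++≈X^⊗ e q)
      (≈P-trans (≈P-sym (X⊗ ((X ^P e) ⊗ q))) (≈P-sym (⊗-assoc X (X ^P e) q)))

  varPow≈X^ : ∀ e → varPow e ≈P (X ^P e)
  varPow≈X^ e = ≈P-trans (0s++≈X^⊗ e one) (⊗-identityʳ _)

  varPow⊗≈0s++ : ∀ e g → (varPow e ⊗ g) ≈P (replicate e 0# ++ g)
  varPow⊗≈0s++ e g = ≈P-trans (⊗-congˡ g (varPow≈X^ e)) (≈P-sym (0s++≈X^⊗ e g))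

  pow≡^P : ∀ q n → pow q n ≡ q ^P n
  pow≡^P q zero    = ≡.refl
  pow≡^P q (suc n) = ≡.cong (q ⊗_) (pow≡^P q n)

  expansion : ∀ q L → length q ≤ L → q ≈P ∑P L (λ a → const (coeff q a) ⊗ (X ^P a))
  expansion []      L       _ = ≈P-sym (P.∑-zero L (λ r _ → ⊗-zeroˡ (const 0#) (X ^P r) (refl , tt)))
  expansion (a ∷ q) (suc L) (s≤s len≤L) = ≈P-sym (≈P-trans (P.∑-head L _)
      (≈P-trans (⊕-cong {const a ⊗ one} {const a} {∑P L (λ r → const (coeff q r) ⊗ (X ^P suc r))} {0# ∷ q}
                  (⊗-identityʳ (const a)) shifted)
                (+-identityʳ a , ≈P-refl)))
    where
    shifted : ∑P L (λ r → const (coeff q r) ⊗ (X ^P suc r)) ≈P (0# ∷ q)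
    shifted = ≈P-trans (P.∑-cong L (λ r _ → ⊗.x∙yz≈y∙xz (const (coeff q r)) X (X ^P r)))
      (≈P-trans (≈P-sym (P.*-distribˡ-∑ L X _)) (≈P-trans (X⊗ _) (refl , ≈P-sym (expansion q L len≤L))))

  Deg≤ : Poly → ℕ → Set ℓ
  Deg≤ q e = ∀ i → e < i → coeff q i ≈ 0#

  Deg≤-one : Deg≤ one 0
  Deg≤-one (suc i) _ = refl

  Deg≤-varPow : ∀ e → Deg≤ (varPow e) e
  Deg≤-varPow zero    (suc i) _         = refl
  Deg≤-varPow (suc e) (suc i) (s≤s e<i) = Deg≤-varPow e i e<i

  Deg≤-⊗ : ∀ p q a b → Deg≤ p a → Deg≤ q b → Deg≤ (p ⊗ q) (a +ℕ b)
  Deg≤-⊗ []      q a b dp dq i _ = refl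
  Deg≤-⊗ (x ∷ p) q a b dp dq i a+b<i = begin
    coeff (scale x q ⊕ (0# ∷ (p ⊗ q))) i          ≈⟨ coeff-⊕ (scale x q) (0# ∷ (p ⊗ q)) i ⟩
    coeff (scale x q) i + coeff (0# ∷ (p ⊗ q)) i  ≈⟨ +-cong (coeff-scale x q i) (shifted a i a+b<i dp) ⟩
    x * coeff q i + 0#                            ≈⟨ +-identityʳ _ ⟩
    x * coeff q i                                 ≈⟨ *-congˡ (dq i (ℕ.≤-trans (s≤s (ℕ.m≤n+m b a)) a+b<i)) ⟩
    x * 0#                                        ≈⟨ zeroʳ x ⟩
    0#                                            ∎
    where
    shifted : ∀ a i → a +ℕ b < i → Deg≤ (x ∷ p) a → coeff (0# ∷ (p ⊗ q)) i ≈ 0#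
    shifted zero    (suc i) _             dp =
      ≈P⇒coeff≈ (p ⊗ q) [] (⊗-zeroˡ p q (coeff≈⇒≈P (λ j → dp (suc j) (s≤s z≤n)))) i
    shifted (suc a) (suc i) (s≤s a+b<i) dp = Deg≤-⊗ p q a b (λ j a<j → dp (suc j) (s≤s a<j)) dq i a+b<i

  Deg≤-pow : ∀ q e n → Deg≤ q e → Deg≤ (pow q n) (n *ℕ e)
  Deg≤-pow q e zero    dq = Deg≤-one
  Deg≤-pow q e (suc n) dq = Deg≤-⊗ q (pow q n) e (n *ℕ e) dq (Deg≤-pow q e n dq)

  ×1≈const×1 : ∀ n → _×1 polynomialRing n ≈P const (_×1 R n)
  ×1≈const×1 zero    = refl , tt
  ×1≈const×1 (suc n) = ⊕-cong {one} {one} {_×1 polynomialRing n} {const (_×1 R n)} (≈P-refl {one}) (×1≈const×1 n)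

  coeff-⊗[Xᵐ-φ] : ∀ m φ q i →
    coeff (q ⊗ (varPow m ⊕ neg (const φ))) i ≈ coeff (replicate m 0# ++ q) i + (- φ) * coeff q i
  coeff-⊗[Xᵐ-φ] m φ q i = begin
    coeff (q ⊗ (varPow m ⊕ neg (const φ))) i
      ≈⟨ ≈P⇒coeff≈ _ _ (⊗-distribˡ q (varPow m) (neg (const φ))) i ⟩
    coeff ((q ⊗ varPow m) ⊕ (q ⊗ const (- φ))) i
      ≈⟨ coeff-⊕ (q ⊗ varPow m) (q ⊗ const (- φ)) i ⟩
    coeff (q ⊗ varPow m) i + coeff (q ⊗ const (- φ)) i
      ≈⟨ +-cong (≈P⇒coeff≈ _ _ (≈P-trans (⊗-comm q (varPow m)) (varPow⊗≈0s++ m q)) i)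
                (≈P⇒coeff≈ _ _ (≈P-trans (⊗-comm q (const (- φ))) (const⊗ (- φ) q)) i) ⟩
    coeff (replicate m 0# ++ q) i + coeff (scale (- φ) q) i
      ≈⟨ +-congˡ (coeff-scale (- φ) q i) ⟩
    coeff (replicate m 0# ++ q) i + (- φ) * coeff q i
      ∎

  -- Comparing coefficients in w = q (Xᵐ − φ) gives q_i ≈ φ q_{m+i}, so every coefficient of q vanishes.
  Xᵐ-φ∣const⇒0 : ∀ m φ q w → 1 ≤ m → w ≈P (q ⊗ (varPow m ⊕ neg (const φ))) →
                 (∀ i → coeff w (suc i) ≈ 0#) → coeff w 0 ≈ 0#
  Xᵐ-φ∣const⇒0 (suc m′) φ q w _ w≈q[Xᵐ-φ] w-const = begin
    coeff w 0                                          ≈⟨ coeff-w 0 ⟩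
    coeff (replicate m 0# ++ q) 0 + (- φ) * coeff q 0  ≈⟨ +-congʳ (reflexive (coeff-0s++-< m q 0 (s≤s z≤n))) ⟩
    0# + (- φ) * coeff q 0                             ≈⟨ +-identityˡ _ ⟩
    (- φ) * coeff q 0                                  ≈⟨ *-congˡ (q≈0 (length q) 0 ℕ.≤-refl) ⟩
    (- φ) * 0#                                         ≈⟨ zeroʳ _ ⟩
    0#                                                 ∎
    where
    open import Algebra.Properties.Ring ring using (-‿distribˡ-*)
    m : ℕ
    m = suc m′
    coeff-w : ∀ i → coeff w i ≈ coeff (replicate m 0# ++ q) i + (- φ) * coeff q i
    coeff-w i = trans (≈P⇒coeff≈ w _ w≈q[Xᵐ-φ] i) (coeff-⊗[Xᵐ-φ] m φ q i)
    recurrence : ∀ i → coeff q i ≈ φ * coeff q (m +ℕ i)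
    recurrence i = begin
      coeff q i
        ≈⟨ +-identityʳ _ ⟨
      coeff q i + 0#
        ≈⟨ +-congˡ (-‿inverseˡ φq) ⟨
      coeff q i + (- φq + φq)
        ≈⟨ +-assoc _ _ _ ⟨
      (coeff q i + - φq) + φq
        ≈⟨ +-congʳ (+-cong (reflexive (≡.sym (coeff-0s++-+ m q i))) (-‿distribˡ-* φ _)) ⟩
      (coeff (replicate m 0# ++ q) (m +ℕ i) + (- φ) * coeff q (m +ℕ i)) + φq
        ≈⟨ +-congʳ (coeff-w (m +ℕ i)) ⟨
      coeff w (m +ℕ i) + φq
        ≈⟨ +-congʳ (w-const (m′ +ℕ i)) ⟩
      0# + φq
        ≈⟨ +-identityˡ _ ⟩
      φq
        ∎
      where
      φq : Carrier
      φq = φ * coeff q (m +ℕ i)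
    q≈0 : ∀ N i → length q ≤ i +ℕ N → coeff q i ≈ 0#
    q≈0 zero    i len≤i = reflexive (coeff-beyond-length q i (≡.subst (length q ≤_) (ℕ.+-identityʳ i) len≤i))
    q≈0 (suc N) i len≤  = trans (recurrence i) (trans (*-congˡ (q≈0 N (m +ℕ i) len≤′)) (zeroʳ φ))
      where
      len≤′ : length q ≤ (m +ℕ i) +ℕ N
      len≤′ = ℕ.≤-trans len≤ (ℕ.≤-trans (ℕ.≤-reflexive (ℕ.+-suc i N))
                 (s≤s (ℕ.≤-trans (ℕ.m≤n+m (i +ℕ N) m′) (ℕ.≤-reflexive (≡.sym (ℕ.+-assoc m′ i N))))))

module PthPowerExpansion {c ℓ : Level} (R : CommutativeRing c ℓ) (p′ : ℕ) (p-prime : Prime (suc p′))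
                         (char : HasCharacteristic R (suc p′)) (perfect : IsPerfect R (suc p′)) where
  open CommutativeRing R
  open Polynomials R
  open CommutativeRingProperties R using (_^_; powR≡^)
  private
    module P = CommutativeRingProperties polynomialRing
  open import Relation.Binary.Reasoning.Setoid (CommutativeRing.setoid polynomialRing)

  p : ℕ
  p = suc p′

  root : Carrier → Carrier
  root a = proj₁ (perfect a)

  open P.PrimeCharacteristic p′ p-prime (≈P-trans (×1≈const×1 p) (char , tt)) using (frobenius-∑)

  rootSum : ℕ → (ℕ → Carrier) → Poly
  rootSum N e = ∑P N (λ s → const (root (e s)) ⊗ (X ^P s))

  rootSum^p⊗X^ : ∀ N e r → ((rootSum N e ^P p) ⊗ (X ^P r)) ≈P ∑P N (λ s → const (e s) ⊗ (X ^P (s *ℕ p +ℕ r)))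
  rootSum^p⊗X^ N e r = begin
    (rootSum N e ^P p) ⊗ (X ^P r)
      ≈⟨ ⊗-congˡ (X ^P r) (frobenius-∑ N _) ⟩
    ∑P N (λ s → (const (root (e s)) ⊗ (X ^P s)) ^P p) ⊗ (X ^P r)
      ≈⟨ P.*-distribʳ-∑ N (X ^P r) _ ⟩
    ∑P N (λ s → ((const (root (e s)) ⊗ (X ^P s)) ^P p) ⊗ (X ^P r))
      ≈⟨ P.∑-cong N (λ s _ → term s) ⟩
    ∑P N (λ s → const (e s) ⊗ (X ^P (s *ℕ p +ℕ r)))
      ∎
    where
    root^p : ∀ a → root a ^ p ≈ a
    root^p a = ≡.subst (_≈ a) (powR≡^ (root a) p) (proj₂ (perfect a))
    term : ∀ s → (((const (root (e s)) ⊗ (X ^P s)) ^P p) ⊗ (X ^P r)) ≈P (const (e s) ⊗ (X ^P (s *ℕ p +ℕ r)))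
    term s = begin
      ((a ⊗ (X ^P s)) ^P p) ⊗ (X ^P r)
        ≈⟨ ⊗-congˡ {(a ⊗ (X ^P s)) ^P p} {(a ^P p) ⊗ ((X ^P s) ^P p)} (X ^P r) (P.^-distrib-* a (X ^P s) p) ⟩
      ((a ^P p) ⊗ ((X ^P s) ^P p)) ⊗ (X ^P r)
        ≈⟨ ⊗-congˡ {(a ^P p) ⊗ ((X ^P s) ^P p)} {const (e s) ⊗ (X ^P (s *ℕ p))} (X ^P r)
                   (⊗-cong {a ^P p} {const (e s)} a^p≈e (P.^-assocʳ X s p)) ⟩
      (const (e s) ⊗ (X ^P (s *ℕ p))) ⊗ (X ^P r)
        ≈⟨ ⊗-assoc (const (e s)) (X ^P (s *ℕ p)) (X ^P r) ⟩
      const (e s) ⊗ ((X ^P (s *ℕ p)) ⊗ (X ^P r))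
        ≈⟨ ⊗-congʳ (const (e s)) (P.^-homo-* X (s *ℕ p) r) ⟨
      const (e s) ⊗ (X ^P (s *ℕ p +ℕ r))
        ∎
      where
      a : Poly
      a = const (root (e s))
      a^p≈e : (a ^P p) ≈P const (e s)
      a^p≈e = ≈P-trans {a ^P p} {const (root (e s) ^ p)} (≈P-sym (const-homo-^ (root (e s)) p)) (root^p (e s) , tt)

  ∑-residues : ∀ W L → length W ≤ L *ℕ p →
               ∑P p (λ r → ∑P L (λ s → const (coeff W (s *ℕ p +ℕ r)) ⊗ (X ^P (s *ℕ p +ℕ r)))) ≈P W
  ∑-residues W L len≤ = begin
    ∑P p (λ r → ∑P L (λ s → const (coeff W (s *ℕ p +ℕ r)) ⊗ (X ^P (s *ℕ p +ℕ r))))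
      ≈⟨ P.∑-* L p (λ a → const (coeff W a) ⊗ (X ^P a)) ⟨
    ∑P (L *ℕ p) (λ a → const (coeff W a) ⊗ (X ^P a))
      ≈⟨ expansion W (L *ℕ p) len≤ ⟨
    W
      ∎

module SuperellipticIdentities {c ℓ : Level} (S : CommutativeRing c ℓ) (m′ : ℕ) where
  import Data.Nat.Properties as ℕ
  open import Data.Nat.Tactic.RingSolver using (solve-∀)
  open CommutativeRing S
  open CommutativeRingProperties S
  open import Algebra.Solver.CommutativeMonoid *-commutativeMonoid using (solve; _⊜_; id) renaming (_⊕_ to _·_)
  open import Algebra.Properties.CommutativeSemigroup *-commutativeSemigroup using (x∙yz≈y∙xz)
  open import Relation.Binary.Reasoning.Setoid setoid

  m : ℕ
  m = suc m′

  module _ {x y φ : Carrier} (y^m≈φ : y ^ m ≈ φ) where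

    y^j*y^m′≈y^[j-1]*φ : ∀ {j} → 1 ≤ j → y ^ j * y ^ m′ ≈ y ^ (j ∸ 1) * φ
    y^j*y^m′≈y^[j-1]*φ {suc j′} _ = begin
      y ^ suc j′ * y ^ m′   ≈⟨ ^-homo-* y (suc j′) m′ ⟨
      y ^ (suc j′ +ℕ m′)     ≡⟨ ≡.cong (y ^_) (ℕ.+-suc j′ m′) ⟨
      y ^ (j′ +ℕ m)          ≈⟨ ^-homo-* y j′ m ⟩
      y ^ j′ * y ^ m         ≈⟨ *-congˡ y^m≈φ ⟩
      y ^ j′ * φ             ∎

    -- The cross-multiplied form of μ y^j G / φ = Σᵢ βᵢ x^i y^{j-1} / (M y^{m-1}), where G = Σᵢ βᵢ x^i.
    ∑-shifted-monomials : ∀ {μ M} j N (β : ℕ → Carrier) → 1 ≤ j → μ * M ≈ 1# →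
      (μ * (y ^ j * ∑ (suc N) (λ i → β i * x ^ i))) * (M * y ^ m′) ^ suc N ≈
      (∑ (suc N) (λ i → β i * (y ^ (j ∸ 1) * x ^ i)) * (M * y ^ m′) ^ N) * φ
    ∑-shifted-monomials {μ} {M} j N β 1≤j μM≈1 = begin
      (μ * (y ^ j * G)) * ((M * y ^ m′) * W)
        ≈⟨ solve 6 (λ μ Y G M Y′ W → (μ · (Y · G)) · ((M · Y′) · W) ⊜ (μ · M) · ((Y · Y′) · (G · W)))
                   refl μ (y ^ j) G M (y ^ m′) W ⟩
      (μ * M) * ((y ^ j * y ^ m′) * (G * W))
        ≈⟨ *-cong μM≈1 (*-congʳ (y^j*y^m′≈y^[j-1]*φ 1≤j)) ⟩
      1# * ((y ^ (j ∸ 1) * φ) * (G * W))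
        ≈⟨ solve 4 (λ Y φ G W → id · ((Y · φ) · (G · W)) ⊜ ((Y · G) · W) · φ) refl (y ^ (j ∸ 1)) φ G W ⟩
      ((y ^ (j ∸ 1) * G) * W) * φ
        ≈⟨ *-congʳ (*-congʳ (trans (*-distribˡ-∑ (suc N) _ _) (∑-cong (suc N) (λ i _ → x∙yz≈y∙xz _ _ _)))) ⟩
      (∑ (suc N) (λ i → β i * (y ^ (j ∸ 1) * x ^ i)) * W) * φ
        ∎
      where
      G W : Carrier
      G = ∑ (suc N) (λ i → β i * x ^ i)
      W = (M * y ^ m′) ^ N

    module _ (p′ : ℕ) where
      private
        p : ℕ
        p = suc p′

      y^jp*y^m′≈y^l′*φ^[t+1] : ∀ {j l′ t} → j *ℕ p ≡ suc l′ +ℕ t *ℕ m →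
                               y ^ (j *ℕ p) * y ^ m′ ≈ y ^ l′ * φ ^ suc t
      y^jp*y^m′≈y^l′*φ^[t+1] {j} {l′} {t} jp≡l+tm = begin
        y ^ (j *ℕ p) * y ^ m′         ≈⟨ ^-homo-* y (j *ℕ p) m′ ⟨
        y ^ (j *ℕ p +ℕ m′)            ≡⟨ ≡.cong (λ e → y ^ (e +ℕ m′)) jp≡l+tm ⟩
        y ^ (suc l′ +ℕ t *ℕ m +ℕ m′)  ≡⟨ ≡.cong (y ^_) (regroup l′ t m′) ⟩
        y ^ (l′ +ℕ m *ℕ suc t)        ≈⟨ ^-homo-* y l′ (m *ℕ suc t) ⟩
        y ^ l′ * y ^ (m *ℕ suc t)     ≈⟨ *-congˡ (^-assocʳ y m (suc t)) ⟨
        y ^ l′ * (y ^ m) ^ suc t      ≈⟨ *-congˡ (^-congˡ (suc t) y^m≈φ) ⟩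
        y ^ l′ * φ ^ suc t            ∎
        where
        regroup : ∀ l′ t m′ → suc l′ +ℕ t *ℕ suc m′ +ℕ m′ ≡ l′ +ℕ suc m′ *ℕ suc t
        regroup = solve-∀

      -- The cross-multiplied form of x^a y^l′ / (M y^{m-1}) = Σ_r (μ y^j G_r / φ)^p x^r.
      ∑-pth-powers : ∀ {μ M j l′ t n a} (G : ℕ → Carrier) →
        μ ^ p * M ≈ 1# → j *ℕ p ≡ suc l′ +ℕ t *ℕ m → n +ℕ suc t ≡ p →
        ∑ p (λ r → G r ^ p * x ^ r) ≈ x ^ a * φ ^ n →
        (∑ p (λ r → (μ * (y ^ j * G r)) ^ p * x ^ r) * (φ ^ p) ^ p′) * (M * y ^ m′) ≈
        (y ^ l′ * x ^ a) * (φ ^ p) ^ p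
      ∑-pth-powers {μ} {M} {j} {l′} {t} {n} {a} G μ^pM≈1 jp≡l+tm n+1+t≡p ∑G^px^r≈x^aφ^n = begin
        (∑ p (λ r → (μ * (y ^ j * G r)) ^ p * x ^ r) * V) * (M * y ^ m′)
          ≈⟨ *-congʳ (*-congʳ (trans (∑-cong p (λ r _ → pull-out r)) (sym (*-distribˡ-∑ p _ _)))) ⟩
        ((μ ^ p * y ^ (j *ℕ p)) * ∑ p (λ r → G r ^ p * x ^ r) * V) * (M * y ^ m′)
          ≈⟨ *-congʳ (*-congʳ (*-congˡ ∑G^px^r≈x^aφ^n)) ⟩
        ((μ ^ p * y ^ (j *ℕ p)) * (x ^ a * φ ^ n) * V) * (M * y ^ m′)
          ≈⟨ solve 7 (λ μ Y X Φ V M Y′ → (((μ · Y) · (X · Φ)) · V) · (M · Y′) ⊜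
                                          (μ · M) · ((Y · Y′) · (X · (Φ · V))))
                     refl (μ ^ p) (y ^ (j *ℕ p)) (x ^ a) (φ ^ n) V M (y ^ m′) ⟩
        (μ ^ p * M) * ((y ^ (j *ℕ p) * y ^ m′) * (x ^ a * (φ ^ n * V)))
          ≈⟨ *-cong μ^pM≈1 (*-congʳ (y^jp*y^m′≈y^l′*φ^[t+1] {j} {l′} {t} jp≡l+tm)) ⟩
        1# * ((y ^ l′ * φ ^ suc t) * (x ^ a * (φ ^ n * V)))
          ≈⟨ solve 5 (λ Y Φ′ X Φ V → id · ((Y · Φ′) · (X · (Φ · V))) ⊜ (Y · X) · ((Φ · Φ′) · V))
                     refl (y ^ l′) (φ ^ suc t) (x ^ a) (φ ^ n) V ⟩
        (y ^ l′ * x ^ a) * ((φ ^ n * φ ^ suc t) * V)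
          ≈⟨ *-congˡ (*-congʳ (trans (sym (^-homo-* φ n (suc t))) (reflexive (≡.cong (φ ^_) n+1+t≡p)))) ⟩
        (y ^ l′ * x ^ a) * (φ ^ p * V)
          ∎
        where
        V : Carrier
        V = (φ ^ p) ^ p′
        pull-out : ∀ r → (μ * (y ^ j * G r)) ^ p * x ^ r ≈ (μ ^ p * y ^ (j *ℕ p)) * (G r ^ p * x ^ r)
        pull-out r = begin
          (μ * (y ^ j * G r)) ^ p * x ^ r
            ≈⟨ *-congʳ (trans (^-distrib-* μ _ p) (*-congˡ (^-distrib-* (y ^ j) (G r) p))) ⟩
          (μ ^ p * ((y ^ j) ^ p * G r ^ p)) * x ^ r
            ≈⟨ *-congʳ (*-congˡ (*-congʳ (^-assocʳ y j p))) ⟩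
          (μ ^ p * (y ^ (j *ℕ p) * G r ^ p)) * x ^ r
            ≈⟨ solve 4 (λ μ Y G X → (μ · (Y · G)) · X ⊜ (μ · Y) · (G · X))
                       refl (μ ^ p) (y ^ (j *ℕ p)) (G r ^ p) (x ^ r) ⟩
          (μ ^ p * y ^ (j *ℕ p)) * (G r ^ p * x ^ r)
            ∎

module Indices (m′ : ℕ) where
  open import Data.Nat
  open import Data.Nat.Properties
  open import Data.Nat.DivMod using (_/_; _%_; m≡m%n+[m/n]*n; m%n<n; m/n*n≤m; %-remove-+ˡ; m<n⇒m%n≡m)
  open import Data.Nat.Divisibility using (∣⇒≤; ∣n⇒∣m*n)
  open import Data.Nat.Tactic.RingSolver using (solve-∀)
  open import Data.Integer as ℤ using (+_)
  import Data.Integer.Properties as ℤ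
  open import Data.Integer.Tactic.RingSolver as ℤ-Solver using ()
  open import Relation.Binary.PropositionalEquality
  open import Relation.Nullary using (yes; no; contradiction)

  m : ℕ
  m = suc m′

  ≡[mod]⇒≤ : ∀ {l J} → l < m → l ≡ J [mod m ] → l ≤ J
  ≡[mod]⇒≤ {l} {J} l<m l≡J with l ≤? J
  ... | yes l≤J = l≤J
  ... | no  l≰J = contradiction (∣⇒≤ m∣l∸J) (<⇒≱ (≤-<-trans (m∸n≤m l J) l<m))
    where
    J<l : J < l
    J<l = ≰⇒> l≰J
    instance
      l∸J≢0 : NonZero (l ∸ J)
      l∸J≢0 = >-nonZero (m<n⇒0<n∸m J<l)
    m∣l∸J : m ∣ l ∸ J
    m∣l∸J = subst (m ∣_) (trans (cong ℤ.∣_∣ (ℤ.m-n≡m⊖n l J)) (trans (ℤ.∣m⊖n∣≡∣n⊖m∣ l J) (ℤ.∣⊖∣-< J<l)))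
                  l≡J

  ≡[mod]⇒∣∸ : ∀ {l J} → l ≤ J → l ≡ J [mod m ] → m ∣ J ∸ l
  ≡[mod]⇒∣∸ {l} {J} l≤J l≡J = subst (m ∣_) (trans (cong ℤ.∣_∣ (ℤ.m-n≡m⊖n l J)) (ℤ.∣⊖∣-≤ l≤J)) l≡J

  ≡[mod]⇒≡+div* : ∀ {l J} → l < m → l ≡ J [mod m ] → J ≡ l + (J div m) * m
  ≡[mod]⇒≡+div* {l} {J} l<m l≡J = trans (m≡m%n+[m/n]*n J m) (cong (_+ (J / m) * m) J%m≡l)
    where
    l≤J : l ≤ J
    l≤J = ≡[mod]⇒≤ l<m l≡J
    J%m≡l : J % m ≡ l
    J%m≡l = begin
      J % m           ≡⟨ cong (_% m) (m∸n+n≡m l≤J) ⟨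
      (J ∸ l + l) % m ≡⟨ %-remove-+ˡ l (≡[mod]⇒∣∸ l≤J l≡J) ⟩
      l % m           ≡⟨ m<n⇒m%n≡m l<m ⟩
      l               ∎
      where open ≡-Reasoning

  m₁<m : ∀ d → m₁ m d < m
  m₁<m d = s≤s (∸-monoˡ-≤ 1 (m∸n≤m m (m div d)))

  ≡1[mod]⇒≡*[mod] : ∀ {p} j → p ≡ 1 [mod m ] → j ≡ j * p [mod m ]
  ≡1[mod]⇒≡*[mod] {p} j p≡1 = subst (m ∣_) (sym j-jp≡j*[p-1]) (∣n⇒∣m*n j p≡1)
    where
    negate : ∀ (a b : ℤ.ℤ) → a ℤ.- a ℤ.* b ≡ ℤ.- (a ℤ.* (b ℤ.- ℤ.+ 1))
    negate = ℤ-Solver.solve-∀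
    j-jp≡j*[p-1] : ℤ.∣ + j ℤ.- + (j * p) ∣ ≡ j * ℤ.∣ + p ℤ.- + 1 ∣
    j-jp≡j*[p-1] = begin
      ℤ.∣ + j ℤ.- + (j * p) ∣              ≡⟨ cong (λ z → ℤ.∣ + j ℤ.- z ∣) (ℤ.pos-* j p) ⟩
      ℤ.∣ + j ℤ.- + j ℤ.* + p ∣            ≡⟨ cong ℤ.∣_∣ (negate (+ j) (+ p)) ⟩
      ℤ.∣ ℤ.- (+ j ℤ.* (+ p ℤ.- + 1)) ∣    ≡⟨ ℤ.∣-i∣≡∣i∣ (+ j ℤ.* (+ p ℤ.- + 1)) ⟩
      ℤ.∣ + j ℤ.* (+ p ℤ.- + 1) ∣          ≡⟨ ℤ.abs-* (+ j) _ ⟩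
      j * ℤ.∣ + p ℤ.- + 1 ∣                ∎
      where open ≡-Reasoning

  module _ (p′ : ℕ) {j : ℕ} (j<m : j < m) where
    private
      p t : ℕ
      p = suc p′
      t = (j * p) div m

    nⱼ+suc-div≡p : nⱼ p m j + suc t ≡ p
    nⱼ+suc-div≡p = trans (+-suc _ t) (cong suc (m∸n+n≡m t≤p′))
      where
      t≤p′ : t ≤ p′
      t≤p′ = ≤-pred (*-cancelʳ-< m t p (≤-<-trans (m/n*n≤m (j * p) m) (subst (j * p <_) (*-comm m p) (*-monoˡ-< p j<m))))

  ≤∸⇒+≤ : ∀ k n o → suc k ≤ o ∸ n → suc k + n ≤ o
  ≤∸⇒+≤ k zero    o       k<o   = subst (_≤ o) (sym (+-identityʳ (suc k))) k<o
  ≤∸⇒+≤ k (suc n) (suc o) k<o∸n = subst (_≤ suc o) (sym (+-suc (suc k) n)) (s≤s (≤∸⇒+≤ k n o k<o∸n))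

  -- Summing the two hypotheses, both sides share the summand B + d t + d.
  index-inequality : ∀ {A B D n t k d p} → d ≡ D + 1 + A → p ≡ n + suc t →
                     p * A ≤ B + d * t → k + 1 + B ≤ d → k + n * d ≤ D * p + (n + t)
  index-inequality {A} {B} {D} {n} {t} {k} refl refl pA≤B+dt k+1+B≤d =
    +-cancelʳ-≤ shared (k + n * d) (D * p + (n + t))
      (subst (_≤ D * p + (n + t) + shared) (rearrange A B D n t k)
        (+-monoʳ-≤ (D * p + (n + t)) (subst (_≤ shared) (+-comm (p * A) _) (+-mono-≤ pA≤B+dt k+1+B≤d))))
    where
    d p shared : ℕ
    d = D + 1 + A
    p = n + suc t
    shared = (B + d * t) + d
    rearrange : ∀ A B D n t k →
      (D * (n + suc t) + (n + t)) + ((k + 1 + B) + (n + suc t) * A) ≡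
      (k + n * (D + 1 + A)) + ((B + (D + 1 + A) * t) + (D + 1 + A))
    rearrange = solve-∀

  module _ (p′ d : ℕ) .{{_ : NonZero d}} {j l : ℕ} (j<m : j < m) (l<m : l < m) (l≡jp : l ≡ j * suc p′ [mod m ]) where
    private
      p t A B D n : ℕ
      p = suc p′
      t = (j * p) div m
      A = (d * j) / m
      B = (d * l) / m
      D = dⱼ m d j
      n = nⱼ p m j

      A*m≤d*j : A * m ≤ d * j
      A*m≤d*j = m/n*n≤m (d * j) m

      d*l<[1+B]*m : d * l < suc B * m
      d*l<[1+B]*m = subst (_< suc B * m) (sym (m≡m%n+[m/n]*n (d * l) m)) (+-monoˡ-< (B * m) (m%n<n (d * l) m))

      p*A≤B+d*t : p * A ≤ B + d * t
      p*A≤B+d*t = ≤-pred (*-cancelʳ-< m (p * A) (suc B + d * t) (begin-strict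
        (p * A) * m             ≡⟨ *-assoc p A m ⟩
        p * (A * m)             ≤⟨ *-monoʳ-≤ p A*m≤d*j ⟩
        p * (d * j)             ≡⟨ reorder p d j ⟩
        (j * p) * d             ≡⟨ cong (_* d) (≡[mod]⇒≡+div* {J = j * p} l<m l≡jp) ⟩
        (l + t * m) * d         ≡⟨ spread l t m d ⟩
        d * l + (d * t) * m     <⟨ +-monoˡ-< ((d * t) * m) d*l<[1+B]*m ⟩
        suc B * m + (d * t) * m ≡⟨ *-distribʳ-+ m (suc B) (d * t) ⟨
        (suc B + d * t) * m     ∎))
        where
        open ≤-Reasoning
        reorder : ∀ p d j → p * (d * j) ≡ (j * p) * d
        reorder = solve-∀
        spread : ∀ l t m d → (l + t * m) * d ≡ d * l + (d * t) * m
        spread = solve-∀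

      d≡D+1+A : d ≡ D + 1 + A
      d≡D+1+A = sym (trans (cong (_+ A) (m∸n+n≡m {d ∸ A} {1} (m<n⇒0<n∸m A<d))) (m∸n+n≡m (<⇒≤ A<d)))
        where
        A<d : A < d
        A<d = *-cancelʳ-< m A d (≤-<-trans A*m≤d*j (*-monoʳ-< d j<m))

      n+t≡p′ : n + t ≡ p′
      n+t≡p′ = suc-injective (trans (sym (+-suc n t)) (nⱼ+suc-div≡p p′ j<m))

    degree-bound : ∀ {k s} → 1 ≤ k → k ≤ dⱼ m d l → D ≤ s → (k ∸ 1) + n * d < s * p + p′
    degree-bound {suc k′} {s} _ k≤dₗ D≤s = begin
      suc k′ + n * d   ≤⟨ index-inequality d≡D+1+A (sym (nⱼ+suc-div≡p p′ j<m)) p*A≤B+d*t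
                            (≤∸⇒+≤ (k′ + 1) B d (≤∸⇒+≤ k′ 1 (d ∸ B) k≤dₗ)) ⟩
      D * p + (n + t)  ≡⟨ cong (λ r → D * p + r) n+t≡p′ ⟩
      D * p + p′       ≤⟨ +-monoˡ-≤ p′ (*-monoˡ-≤ p D≤s) ⟩
      s * p + p′       ∎
      where open ≤-Reasoning

module CartierOnSuperelliptic
    {c ℓ : Level} (R : CommutativeRing c ℓ) (isField : IsField R)
    (p′ : ℕ) (p-prime : Prime (suc p′)) (char : HasCharacteristic R (suc p′)) (perfect : IsPerfect R (suc p′))
    (m′ : ℕ) (p∤m : ¬ (suc p′ ∣ suc m′))
    (d : ℕ) .{{_ : NonZero d}} (fv : Vec (CommutativeRing.Carrier R) (suc d))
    (lead≉0 : ¬ (CommutativeRing._≈_ R (last fv) (CommutativeRing.0# R))) where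
  open import Data.Nat.Divisibility using (_∣?_)
  open import Relation.Nullary using (Dec; yes; no; contradiction)
  import Data.Nat.Properties as ℕ
  open Superelliptic R using (Poly; Bivar; mon; Fpoly; module Field; bcoef)

  p m : ℕ
  p = suc p′
  m = suc m′

  f : Poly
  f = toList fv

  open Field m f

  module k = CommutativeRing R
  module K = CommutativeRingProperties R
  module k[x] = Polynomials R
  module k[x,y] = Polynomials k[x].polynomialRing
  open PthPowerExpansion R p′ p-prime char perfect using (root; rootSum; rootSum^p⊗X^; ∑-residues)
  private
    module Q = PrincipalQuotient k[x,y].polynomialRing (Fpoly m f)
  open CommutativeRing Q.quotientRing
  open CommutativeRingProperties Q.quotientRing using (_^_; ∑; ∑-cong; ∑-zero; ∑-split; 1^n≈1; ^-distrib-*; ^-congˡ)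
  open import Relation.Binary.Reasoning.Setoid setoid

  ι : Poly → Bivar
  ι g = g ∷ []

  κ : k.Carrier → Bivar
  κ a = ι (k[x].const a)

  x y : Bivar
  x = mon 1 0
  y = mon 0 1

  ^≡^P : ∀ u n → u ^ n ≡ u k[x,y].^P n
  ^≡^P u zero    = ≡.refl
  ^≡^P u (suc n) = ≡.cong (u k[x,y].⊗_) (^≡^P u n)

  ι-cong : ∀ {g h} → g k[x].≈P h → ι g ≈ ι h
  ι-cong g≈h = Q.≈⇒~ (g≈h , tt)

  ι-homo-* : ∀ g h → ι (g k[x].⊗ h) ≈ ι g * ι h
  ι-homo-* g h = Q.≈⇒~ (k[x,y].const-homo-* g h)

  ι-homo-^ : ∀ g n → ι (g k[x].^P n) ≈ ι g ^ n
  ι-homo-^ g n rewrite ^≡^P (ι g) n = Q.≈⇒~ (k[x,y].const-homo-^ g n)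

  ι-homo-∑ : ∀ n g → ι (k[x].∑P n g) ≈ ∑ n (λ r → ι (g r))
  ι-homo-∑ zero    g = Q.≈⇒~ (tt , tt)
  ι-homo-∑ (suc n) g = +-congʳ (ι-homo-∑ n g)

  κ-cong : ∀ {a b} → a k.≈ b → κ a ≈ κ b
  κ-cong a≈b = ι-cong (a≈b , tt)

  κ0≈0 : κ k.0# ≈ 0#
  κ0≈0 = Q.≈⇒~ ((k.refl , tt) , tt)

  κ-homo-* : ∀ a b → κ (a k.* b) ≈ κ a * κ b
  κ-homo-* a b = trans (ι-cong (k[x].const-homo-* a b)) (ι-homo-* (k[x].const a) (k[x].const b))

  κ-homo-^ : ∀ a n → κ (a K.^ n) ≈ κ a ^ n
  κ-homo-^ a n = trans (ι-cong (k[x].const-homo-^ a n)) (ι-homo-^ (k[x].const a) n)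

  mon≈y^*x^ : ∀ a b → mon a b ≈ y ^ b * x ^ a
  mon≈y^*x^ a b = begin
    mon a b                                        ≈⟨ Q.≈⇒~ (k[x,y].0s++≈X^⊗ b (ι (k[x].varPow a))) ⟩
    (y k[x,y].^P b) k[x,y].⊗ ι (k[x].varPow a)     ≡⟨ ≡.cong (_* ι (k[x].varPow a)) (^≡^P y b) ⟨
    y ^ b * ι (k[x].varPow a)
      ≈⟨ *-congˡ {y ^ b} (trans (ι-cong (k[x].varPow≈X^ a)) (ι-homo-^ k[x].X a)) ⟩
    y ^ b * x ^ a                                  ∎

  y^m≈ιf : y ^ m ≈ ι f
  y^m≈ιf = begin
    y ^ m                       ≡⟨ ^≡^P y m ⟩
    y k[x,y].^P m               ≈⟨ Q.≈⇒~ (k[x,y].varPow≈X^ m) ⟨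
    mon 0 m                     ≈⟨ +-identityʳ (mon 0 m) ⟨
    mon 0 m + 0#                ≈⟨ +-congˡ {mon 0 m} (-‿inverseˡ (ι f)) ⟨
    mon 0 m + (- ι f + ι f)     ≈⟨ +-assoc (mon 0 m) (- ι f) (ι f) ⟨
    Fpoly m f + ι f             ≈⟨ +-congʳ {ι f} Q.generator~0 ⟩
    0# + ι f                    ≈⟨ +-identityˡ (ι f) ⟩
    ι f                         ∎

  coeff-last : ∀ {n} (v : Vec k.Carrier (suc n)) → k[x].coeff (toList v) n ≡ last v
  coeff-last (a Data.Vec.∷ Data.Vec.[])    = ≡.refl
  coeff-last (a Data.Vec.∷ b Data.Vec.∷ v) = coeff-last (b Data.Vec.∷ v)

  ιf∉⟨F⟩ : ¬ (ι f ≡I [])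
  ιf∉⟨F⟩ (q , ιf≈qF) = lead≉0 (≡.subst (k._≈ k.0#) (coeff-last fv) (k[x].≈P⇒coeff≈ f [] f≈0 d))
    where
    f≈0 : f k[x].≈P []
    f≈0 = k[x,y].Xᵐ-φ∣const⇒0 m f q (ι f) (s≤s z≤n) ιf≈qF (λ _ → tt)

  m̂ : k.Carrier
  m̂ = _×1 R m

  m̂≉0 : ¬ (m̂ k.≈ k.0#)
  m̂≉0 = K.PrimeCharacteristic.p∤n⇒n×1≉0 p′ p-prime char (proj₁ isField) p∤m

  μ : k.Carrier
  μ = proj₁ (proj₂ isField m̂ m̂≉0)

  κμ*κm̂≈1 : κ μ * κ m̂ ≈ 1#
  κμ*κm̂≈1 = trans (sym (κ-homo-* μ m̂)) (κ-cong (k.trans (k.*-comm μ m̂) (proj₂ (proj₂ isField m̂ m̂≉0))))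

  κμ^p*κm̂≈1 : κ μ ^ p * κ m̂ ≈ 1#
  κμ^p*κm̂≈1 = begin
    κ μ ^ p * κ m̂          ≈⟨ *-congˡ {κ μ ^ p} (κ-cong (K.PrimeCharacteristic.fermat p′ p-prime char m)) ⟨
    κ μ ^ p * κ (m̂ K.^ p)  ≈⟨ *-congˡ {κ μ ^ p} (κ-homo-^ m̂ p) ⟩
    κ μ ^ p * κ m̂ ^ p      ≈⟨ ^-distrib-* (κ μ) (κ m̂) p ⟨
    (κ μ * κ m̂) ^ p        ≈⟨ ^-congˡ p κμ*κm̂≈1 ⟩
    1# ^ p                 ≈⟨ 1^n≈1 p ⟩
    1#                     ∎

  num-powK : ∀ z n → proj₁ (powK z n) ≡ proj₁ z ^ n
  num-powK z zero    = ≡.refl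
  num-powK z (suc n) = ≡.cong (proj₁ z *_) (num-powK z n)

  den-powK : ∀ z n → proj₂ (powK z n) ≡ proj₂ z ^ n
  den-powK z zero    = ≡.refl
  den-powK z (suc n) = ≡.cong (proj₂ z *_) (den-powK z n)

  sumK-common-denominator : ∀ n g V → (∀ r → proj₂ (g r) ≈ V) →
    proj₂ (sumK (suc n) g) ≈ V ^ suc n × proj₁ (sumK (suc n) g) ≈ ∑ (suc n) (λ r → proj₁ (g r)) * V ^ n
  sumK-common-denominator zero    g V g≈V =
    trans (*-identityˡ (proj₂ (g 0))) (trans (g≈V 0) (sym (*-identityʳ V))) ,
    trans (+-cong (zeroˡ (proj₂ (g 0))) (*-identityʳ (proj₁ (g 0)))) (sym (*-identityʳ (0# + proj₁ (g 0))))
  sumK-common-denominator (suc n) g V g≈V = den≈ , num≈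
    where
    IH : proj₂ (sumK (suc n) g) ≈ V ^ suc n × proj₁ (sumK (suc n) g) ≈ ∑ (suc n) (λ r → proj₁ (g r)) * V ^ n
    IH = sumK-common-denominator n g V g≈V
    Σn u : Bivar
    Σn = ∑ (suc n) (λ r → proj₁ (g r))
    u = proj₁ (g (suc n))
    den≈ : proj₂ (sumK (2 +ℕ n) g) ≈ V ^ (2 +ℕ n)
    den≈ = trans (*-cong (proj₁ IH) (g≈V (suc n))) (*-comm (V ^ suc n) V)
    num≈ : proj₁ (sumK (2 +ℕ n) g) ≈ ∑ (2 +ℕ n) (λ r → proj₁ (g r)) * V ^ suc n
    num≈ = begin
      proj₁ (sumK (suc n) g) * proj₂ (g (suc n)) + u * proj₂ (sumK (suc n) g)
        ≈⟨ +-cong (*-cong (proj₂ IH) (g≈V (suc n))) (*-congˡ {u} (proj₁ IH)) ⟩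
      (Σn * V ^ n) * V + u * V ^ suc n
        ≈⟨ +-congʳ {u * V ^ suc n} (trans (*-assoc Σn (V ^ n) V) (*-congˡ {Σn} (*-comm (V ^ n) V))) ⟩
      Σn * V ^ suc n + u * V ^ suc n
        ≈⟨ distribʳ (V ^ suc n) Σn u ⟨
      (Σn + u) * V ^ suc n ∎

  ι-monomials : ∀ N (e : ℕ → k.Carrier) (a : ℕ → ℕ) →
    ι (k[x].∑P N (λ s → k[x].const (e s) k[x].⊗ (k[x].X k[x].^P a s))) ≈ ∑ N (λ s → κ (e s) * x ^ a s)
  ι-monomials N e a = trans (ι-homo-∑ N _) (∑-cong N (λ s _ →
    trans (ι-homo-* (k[x].const (e s)) (k[x].X k[x].^P a s)) (*-congˡ {κ (e s)} (ι-homo-^ k[x].X (a s)))))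

  rootFrac : ℕ → Bivar → Frac
  rootFrac j g = κ μ * (y ^ j * g) , ι f

  open SuperellipticIdentities Q.quotientRing m′ using (∑-shifted-monomials; ∑-pth-powers)

  ∑-scalar*ω : ∀ j N (β : ℕ → k.Carrier) {g} → 1 ≤ j → g ≈ ∑ N (λ s → κ (β s) * x ^ s) →
    rootFrac j g ≈K sumK N (λ i → scalarK (β i) *K ω (suc i) j)
  ∑-scalar*ω j zero    β {g} _   g≈0 = Q.~⇒Σ (begin
    (κ μ * (y ^ j * g)) * 1#    ≈⟨ *-identityʳ (κ μ * (y ^ j * g)) ⟩
    κ μ * (y ^ j * g)           ≈⟨ *-congˡ {κ μ} (*-congˡ {y ^ j} g≈0) ⟩
    κ μ * (y ^ j * 0#)          ≈⟨ *-congˡ {κ μ} (zeroʳ (y ^ j)) ⟩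
    κ μ * 0#                    ≈⟨ zeroʳ (κ μ) ⟩
    0#                          ∎)
  ∑-scalar*ω j (suc N) β {g} 1≤j g≈G = Q.~⇒Σ (begin
    (κ μ * (y ^ j * g)) * proj₂ h
      ≈⟨ *-cong (*-congˡ {κ μ} (*-congˡ {y ^ j} g≈G)) (proj₁ common) ⟩
    (κ μ * (y ^ j * G)) * V ^ suc N
      ≈⟨ ∑-shifted-monomials {x} {y} {ι f} y^m≈ιf {κ μ} {κ m̂} j N κβ 1≤j κμ*κm̂≈1 ⟩
    (∑ (suc N) (λ i → κ (β i) * (y ^ (j ∸ 1) * x ^ i)) * V ^ N) * ι f
      ≈⟨ *-congʳ {ι f} (*-congʳ {V ^ N} (∑-cong (suc N) (λ i _ → *-congˡ {κ (β i)} (sym (mon≈y^*x^ i (j ∸ 1)))))) ⟩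
    (∑ (suc N) (λ i → κ (β i) * mon i (j ∸ 1)) * V ^ N) * ι f
      ≈⟨ *-congʳ {ι f} (proj₂ common) ⟨
    proj₁ h * ι f
      ∎)
    where
    κβ : ℕ → Bivar
    κβ i = κ (β i)
    G V : Bivar
    G = ∑ (suc N) (λ s → κ (β s) * x ^ s)
    V = κ m̂ * y ^ m′
    h : Frac
    h = sumK (suc N) (λ i → scalarK (β i) *K ω (suc i) j)
    common : proj₂ h ≈ V ^ suc N × proj₁ h ≈ ∑ (suc N) (λ i → κ (β i) * mon i (j ∸ 1)) * V ^ N
    common = sumK-common-denominator N _ V (λ i →
      trans (*-identityˡ (κ m̂ * mon 0 m′)) (*-congˡ {κ m̂} (trans (mon≈y^*x^ 0 m′) (*-identityʳ (y ^ m′)))))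

  ω≈∑rootFrac^p*x^ : ∀ {j l k n t} (G : ℕ → Bivar) → 1 ≤ l → j *ℕ p ≡ l +ℕ t *ℕ m → n +ℕ suc t ≡ p →
    ∑ p (λ r → G r ^ p * x ^ r) ≈ x ^ (k ∸ 1) * ι f ^ n →
    ω k l ≈K sumK p (λ r → powK (rootFrac j (G r)) p *K powK xK r)
  ω≈∑rootFrac^p*x^ {j} {suc l′} {k} {n} {t} G _ jp≡l+tm n+t+1≡p ∑G^px^r≈x^kιf^n = Q.~⇒Σ (sym (begin
    proj₁ S * (κ m̂ * mon 0 m′)
      ≈⟨ *-cong (proj₂ common) (*-congˡ {κ m̂} (trans (mon≈y^*x^ 0 m′) (*-identityʳ (y ^ m′)))) ⟩
    (∑ p (λ r → proj₁ (term r)) * V ^ p′) * (κ m̂ * y ^ m′)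
      ≈⟨ *-congʳ {κ m̂ * y ^ m′} (*-congʳ {V ^ p′} (∑-cong p (λ r _ → reflexive
           (≡.cong₂ _*_ (num-powK (rootFrac j (G r)) p) (num-powK xK r))))) ⟩
    (∑ p (λ r → (κ μ * (y ^ j * G r)) ^ p * x ^ r) * V ^ p′) * (κ m̂ * y ^ m′)
      ≈⟨ ∑-pth-powers {x} {y} {ι f} y^m≈ιf p′ {κ μ} {κ m̂} {j} {l′} {t} {n} {k ∸ 1} G
           κμ^p*κm̂≈1 jp≡l+tm n+t+1≡p ∑G^px^r≈x^kιf^n ⟩
    (y ^ l′ * x ^ (k ∸ 1)) * V ^ p
      ≈⟨ *-cong (sym (mon≈y^*x^ (k ∸ 1) l′)) (sym (proj₁ common)) ⟩
    mon (k ∸ 1) l′ * proj₂ S ∎))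
    where
    term : ℕ → Frac
    term r = powK (rootFrac j (G r)) p *K powK xK r
    S : Frac
    S = sumK p term
    V : Bivar
    V = ι f ^ p
    common : proj₂ S ≈ V ^ p × proj₁ S ≈ ∑ p (λ r → proj₁ (term r)) * V ^ p′
    common = sumK-common-denominator p′ term V (λ r → begin
      proj₂ (term r)    ≡⟨ ≡.cong₂ _*_ (den-powK (rootFrac j (G r)) p) (den-powK xK r) ⟩
      V * 1# ^ r        ≈⟨ *-congˡ {V} (1^n≈1 r) ⟩
      V * 1#            ≈⟨ *-identityʳ V ⟩
      V                 ∎)

  bcoef≈coeff : ∀ {j l k} s → l ≤ j *ℕ p → m ∣ j *ℕ p ∸ l → 1 ≤ k →
    bcoef p m f j l (suc s) k k.≈ k[x].coeff (k[x].varPow (k ∸ 1) k[x].⊗ k[x].pow f (nⱼ p m j)) (s *ℕ p +ℕ p′)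
  bcoef≈coeff {j} {l} {k} s l≤jp m∣jp∸l 1≤k = k.trans (bcoef≈ k 1≤k) (k.sym coeff-W)
    where
    fⁿ : Poly
    fⁿ = k[x].pow f (nⱼ p m j)
    coeff-W : k[x].coeff (k[x].varPow (k ∸ 1) k[x].⊗ fⁿ) (s *ℕ p +ℕ p′)
              k.≈ k[x].coeff (replicate (k ∸ 1) k.0# ++ fⁿ) (s *ℕ p +ℕ p′)
    coeff-W = k[x].≈P⇒coeff≈ _ _ (k[x].varPow⊗≈0s++ (k ∸ 1) fⁿ) (s *ℕ p +ℕ p′)
    bcoef≈ : ∀ k → 1 ≤ k → bcoef p m f j l (suc s) k k.≈ k[x].coeff (replicate (k ∸ 1) k.0# ++ fⁿ) (s *ℕ p +ℕ p′)
    bcoef≈ (suc k′) _ with l ℕ.≤? j *ℕ p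
    ... | no l≰jp = contradiction l≤jp l≰jp
    ... | yes _ with m ∣? (j *ℕ p ∸ l)
    ...   | no m∤ = contradiction m∣jp∸l m∤
    ...   | yes _ with suc k′ ℕ.≤? suc s *ℕ p
    ...     | no k≰ = k.reflexive (≡.sym (k[x].coeff-0s++-< k′ fⁿ (s *ℕ p +ℕ p′) index<k′))
      where
      index<k′ : s *ℕ p +ℕ p′ < k′
      index<k′ = ≡.subst (_< k′) (ℕ.+-comm p′ (s *ℕ p)) (ℕ.≤-pred (ℕ.≰⇒> k≰))
    ...     | yes k≤ = k.reflexive (≡.sym (≡.trans (≡.cong (k[x].coeff (replicate k′ k.0# ++ fⁿ)) index≡)
                                                  (k[x].coeff-0s++-+ k′ fⁿ (suc s *ℕ p ∸ suc k′))))
      where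
      index≡ : s *ℕ p +ℕ p′ ≡ k′ +ℕ (suc s *ℕ p ∸ suc k′)
      index≡ = ≡.trans (ℕ.+-comm (s *ℕ p) p′) (≡.sym (ℕ.m+[n∸m]≡n (ℕ.≤-pred k≤)))

  ι-rootSum^p*x^ : ∀ N e r → ι (rootSum N e) ^ p * x ^ r ≈ ∑ N (λ s → κ (e s) * x ^ (s *ℕ p +ℕ r))
  ι-rootSum^p*x^ N e r = begin
    ι (rootSum N e) ^ p * x ^ r
      ≈⟨ *-cong (ι-homo-^ (rootSum N e) p) (ι-homo-^ k[x].X r) ⟨
    ι (rootSum N e k[x].^P p) * ι (k[x].X k[x].^P r)
      ≈⟨ ι-homo-* (rootSum N e k[x].^P p) (k[x].X k[x].^P r) ⟨
    ι ((rootSum N e k[x].^P p) k[x].⊗ (k[x].X k[x].^P r))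
      ≈⟨ ι-cong (rootSum^p⊗X^ N e r) ⟩
    ι (k[x].∑P N (λ s → k[x].const (e s) k[x].⊗ (k[x].X k[x].^P (s *ℕ p +ℕ r))))
      ≈⟨ ι-monomials N e (λ s → s *ℕ p +ℕ r) ⟩
    ∑ N (λ s → κ (e s) * x ^ (s *ℕ p +ℕ r))
      ∎

  Deg≤-f : k[x].Deg≤ f d
  Deg≤-f i d<i = k.reflexive (k[x].coeff-beyond-length f i (≡.subst (_≤ i) (≡.sym (length-toList fv)) d<i))
    where open import Data.Vec.Properties using (length-toList)

  module CartierImage {j l k : ℕ} (j<m : j < m) (l<m : l < m) (l≡jp : l ≡ j *ℕ p [mod m ])
               (1≤j : 1 ≤ j) (1≤l : 1 ≤ l) (1≤k : 1 ≤ k) (k≤dₗ : k ≤ dⱼ m d l) where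
    open Indices m′ hiding (m)

    n D t : ℕ
    n = nⱼ p m j
    D = dⱼ m d j
    t = (j *ℕ p) div m

    W : Poly
    W = k[x].varPow (k ∸ 1) k[x].⊗ k[x].pow f n

    L : ℕ
    L = D +ℕ length W

    β : ℕ → k.Carrier
    β s = bcoef p m f j l (suc s) k

    l≤jp : l ≤ j *ℕ p
    l≤jp = ≡[mod]⇒≤ l<m l≡jp

    -- Beyond index D the coefficients of the top residue class vanish (degree-bound), but p-th roots of
    -- zero need not be provably zero here, so that class is truncated at D before taking roots; then the
    -- component z (p ∸ 1) of the decomposition is literally the claimed image.
    G-cases : ∀ r → Dec (r ≡ p′) → Poly
    G-cases r (yes _) = rootSum D β
    G-cases r (no _)  = rootSum L (λ s → k[x].coeff W (s *ℕ p +ℕ r))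

    G : ℕ → Poly
    G r = G-cases r (r ℕ.≟ p′)

    top-class : ∑ D (λ s → κ (β s) * x ^ (s *ℕ p +ℕ p′)) ≈
                ∑ L (λ s → κ (k[x].coeff W (s *ℕ p +ℕ p′)) * x ^ (s *ℕ p +ℕ p′))
    top-class = begin
      ∑ D (λ s → κ (β s) * x ^ (s *ℕ p +ℕ p′))
        ≈⟨ ∑-cong D (λ s _ → *-congʳ {x ^ (s *ℕ p +ℕ p′)}
                                     (κ-cong (bcoef≈coeff s l≤jp (≡[mod]⇒∣∸ l≤jp l≡jp) 1≤k))) ⟩
      ∑ D h
        ≈⟨ +-identityʳ (∑ D h) ⟨
      ∑ D h + 0#
        ≈⟨ +-congˡ {∑ D h} (∑-zero (length W) (λ i _ → beyond-D i)) ⟨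
      ∑ D h + ∑ (length W) (λ i → h (D +ℕ i))
        ≈⟨ ∑-split D (length W) h ⟨
      ∑ L h
        ∎
      where
      h : ℕ → Bivar
      h s = κ (k[x].coeff W (s *ℕ p +ℕ p′)) * x ^ (s *ℕ p +ℕ p′)
      Deg≤-W : k[x].Deg≤ W ((k ∸ 1) +ℕ n *ℕ d)
      Deg≤-W = k[x].Deg≤-⊗ (k[x].varPow (k ∸ 1)) (k[x].pow f n) (k ∸ 1) (n *ℕ d)
                         (k[x].Deg≤-varPow (k ∸ 1)) (k[x].Deg≤-pow f d n Deg≤-f)
      beyond-D : ∀ i → h (D +ℕ i) ≈ 0#
      beyond-D i = trans (*-congʳ {x ^ ((D +ℕ i) *ℕ p +ℕ p′)} (trans (κ-cong (Deg≤-W _ D+i-beyond-degree)) κ0≈0))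
                         (zeroˡ (x ^ ((D +ℕ i) *ℕ p +ℕ p′)))
        where
        D+i-beyond-degree : (k ∸ 1) +ℕ n *ℕ d < (D +ℕ i) *ℕ p +ℕ p′
        D+i-beyond-degree = degree-bound p′ d j<m l<m l≡jp 1≤k k≤dₗ (ℕ.m≤m+n D i)

    residue-class : ∀ r → ι (G r) ^ p * x ^ r ≈ ∑ L (λ s → κ (k[x].coeff W (s *ℕ p +ℕ r)) * x ^ (s *ℕ p +ℕ r))
    residue-class r = class-cases (r ℕ.≟ p′)
      where
      class-cases : ∀ r≟p′ →
        ι (G-cases r r≟p′) ^ p * x ^ r ≈ ∑ L (λ s → κ (k[x].coeff W (s *ℕ p +ℕ r)) * x ^ (s *ℕ p +ℕ r))
      class-cases (yes ≡.refl) = trans (ι-rootSum^p*x^ D β p′) top-class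
      class-cases (no _)       = ι-rootSum^p*x^ L (λ s → k[x].coeff W (s *ℕ p +ℕ r)) r

    decomposition : ∑ p (λ r → ι (G r) ^ p * x ^ r) ≈ x ^ (k ∸ 1) * ι f ^ n
    decomposition = begin
      ∑ p (λ r → ι (G r) ^ p * x ^ r)
        ≈⟨ ∑-cong p (λ r _ → residue-class r) ⟩
      ∑ p (λ r → ∑ L (λ s → κ (coeffW (s *ℕ p +ℕ r)) * x ^ (s *ℕ p +ℕ r)))
        ≈⟨ ∑-cong p (λ r _ → ι-monomials L (λ s → coeffW (s *ℕ p +ℕ r)) (λ s → s *ℕ p +ℕ r)) ⟨
      ∑ p (λ r → ι (classes r))
        ≈⟨ ι-homo-∑ p classes ⟨
      ι (k[x].∑P p classes)
        ≈⟨ ι-cong {k[x].∑P p classes} {W} (∑-residues W L length≤L*p) ⟩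
      ι W
        ≈⟨ ι-homo-* (k[x].varPow (k ∸ 1)) (k[x].pow f n) ⟩
      ι (k[x].varPow (k ∸ 1)) * ι (k[x].pow f n)
        ≈⟨ *-cong (trans (ι-cong (k[x].varPow≈X^ (k ∸ 1))) (ι-homo-^ k[x].X (k ∸ 1)))
                  (trans (reflexive (≡.cong ι (k[x].pow≡^P f n))) (ι-homo-^ f n)) ⟩
      x ^ (k ∸ 1) * ι f ^ n
        ∎
      where
      coeffW : ℕ → k.Carrier
      coeffW = k[x].coeff W
      classes : ℕ → Poly
      classes r = k[x].∑P L (λ s → k[x].const (coeffW (s *ℕ p +ℕ r)) k[x].⊗ (k[x].X k[x].^P (s *ℕ p +ℕ r)))
      length≤L*p : length W ≤ L *ℕ p
      length≤L*p = ℕ.≤-trans (ℕ.m≤n+m (length W) D) (ℕ.m≤m*n L p)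

    image : CartierMaps p (ω k l) (sumK D (λ i → scalarK (root (β i)) *K ω (suc i) j))
    image = (λ r → rootFrac j (ι (G r))) , (λ _ _ → ιf∉⟨F⟩) ,
            ω≈∑rootFrac^p*x^ {j} {l} {k} {n} {t} (λ r → ι (G r)) 1≤l (≡[mod]⇒≡+div* {l} {j *ℕ p} l<m l≡jp)
              (nⱼ+suc-div≡p p′ j<m) decomposition ,
            top-image (p′ ℕ.≟ p′)
      where
      top-image : ∀ p′≟p′ →
        rootFrac j (ι (G-cases p′ p′≟p′)) ≈K sumK D (λ i → scalarK (root (β i)) *K ω (suc i) j)
      top-image (yes _)      = ∑-scalar*ω j D (λ s → root (β s)) 1≤j (ι-monomials D (λ s → root (β s)) (λ s → s))
      top-image (no p′≢p′)   = contradiction ≡.refl p′≢p′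

theorem3 : {c ℓ : Level} (R : CommutativeRing c ℓ) →
  let open CommutativeRing R
      open Superelliptic R
  in
  IsField R →
  (p : ℕ) → Prime p → HasCharacteristic R p →
  (perfect : IsPerfect R p) →
  (m : ℕ) → 2 ≤ m → ¬ (p ∣ m) →
  (d : ℕ) → 3 ≤ d →
  (fv : Vec Carrier (ℕ.suc d)) → ¬ (last fv ≈ 0#) → SquareFree (toList fv) →
  let f = toList fv
      open Field m f
      root : Carrier → Carrier
      root a = proj₁ (perfect a)
  in
  ((j l : ℕ) → 1 ≤ j → j ≤ m₁ m d → 1 ≤ l → l ≤ m₁ m d → l ≡ j *ℕ p [mod m ] →
    (k : ℕ) → 1 ≤ k → k ≤ dⱼ m d l →
    CartierMaps p (ω k l)
      (sumK (dⱼ m d j) (λ i → scalarK (root (bcoef p m f j l (ℕ.suc i) k)) *K ω (ℕ.suc i) j)))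
  ×
  (p ≡ 1 [mod m ] →
    (j : ℕ) → 1 ≤ j → j ≤ m₁ m d →
    (k : ℕ) → 1 ≤ k → k ≤ dⱼ m d j →
    Σ (ℕ → Carrier) λ a →
      CartierMaps p (ω k j) (sumK (dⱼ m d j) (λ i → scalarK (a (ℕ.suc i)) *K ω (ℕ.suc i) j)))
theorem3 R isField zero p-prime = ⊥-elim (NonZero.nonZero (prime⇒nonZero p-prime))
theorem3 R isField (suc p′) p-prime char perfect zero ()
theorem3 R isField (suc p′) p-prime char perfect (suc m′) _ p∤m d 3≤d fv lead≉0 _ =
  (λ j l 1≤j j≤m₁ 1≤l l≤m₁ l≡jp k 1≤k k≤dₗ →
     image (<m j≤m₁) (<m l≤m₁) l≡jp 1≤j 1≤l 1≤k k≤dₗ) ,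
  (λ p≡1 j 1≤j j≤m₁ k 1≤k k≤dⱼ →
     (λ i → proj₁ (perfect (Superelliptic.bcoef R (suc p′) (suc m′) (toList fv) j j i k))) ,
     image (<m j≤m₁) (<m j≤m₁) (≡1[mod]⇒≡*[mod] j p≡1) 1≤j 1≤j 1≤k k≤dⱼ)
  where
  open Indices m′ using (m₁<m; ≡1[mod]⇒≡*[mod])
  open CartierOnSuperelliptic R isField p′ p-prime char perfect m′ p∤m
         d {{>-nonZero (≤-trans (s≤s z≤n) 3≤d)}} fv lead≉0 using (module CartierImage)
  open CartierImage using (image)
  <m : ∀ {j} → j ≤ m₁ (suc m′) d → j < suc m′
  <m j≤m₁ = ≤-<-trans j≤m₁ (m₁<m d)
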